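{- Let $K$ be a field of characteristic different from $2$ and let $L/K$ be a Galois extension of odd degree $n=2m+1$, with Galois group $G=\{1,\sigma_1,\dots,\sigma_m,\sigma_1^{ -1},\dots,\sigma_m^{ -1}\}$. Set $\sigma_0=1$ and, for $0\le i\le m$, $A^{i}=\{\phi_{b,\sigma_i}:b\in L\}$, where $\phi_{b,\sigma}(x,y)=\mathrm{tr}^L_K\big(b(x\sigma(y)+\sigma(x)y)\big)$. Then there is an (internal) direct sum decomposition $$\mathrm{Sym}_K(L)=A^0\oplus A^1\oplus\cdots\oplus A^m,$$ where each $A^i$, $1\le i\le m$, is an $n$-dimensional $n$-subspace of $\mathrm{Sym}_K(L)$.
   Context: $\mathrm{Sym}_K(L)$ is the $K$-space of symmetric $K$-bilinear forms $L\times L\to K$ (of dimension $n(n+1)/2$). $\mathrm{tr}^L_K(a)=\sum_{\tau\in G}\tau(a)$. For an integer $k$, a $k$-subspace of $\mathrm{Sym}_K(L)$ is a subspace all of whose nonzero elements have rank exactly $k$; in particular an $n$-subspace is one whose nonzero elements are all non-degenerate. -}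

module Defs where

open import Level using (Level; _⊔_)
open import Data.Nat using (ℕ; zero; suc) renaming (_+_ to _+ℕ_)
open import Data.Fin using (Fin; zero; suc; splitAt)
open import Data.Sum using (_⊎_; inj₁; inj₂)
open import Data.Product using (Σ; ∃; _×_; _,_)
open import Relation.Nullary using (¬_)
open import Algebra.Bundles using (CommutativeRing)
open import Relation.Binary.PropositionalEquality using (_≡_)

module _ {c ℓ} (R : CommutativeRing c ℓ) where
  open CommutativeRing R using (Carrier; 0#) renaming (_+_ to _⊕_)
  sumFin : ∀ {n} → (Fin n → Carrier) → Carrier
  sumFin {zero}  f = 0#
  sumFin {suc n} f = f zero ⊕ sumFin (λ i → f (suc i))

record Field (c ℓ : Level) : Set (Level.suc (c ⊔ ℓ)) where
  field
    commRing : CommutativeRing c ℓ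
  open CommutativeRing commRing public
  field
    1≉0 : ¬ (1# ≈ 0#)
    inverse : ∀ x → ¬ (x ≈ 0#) → Σ Carrier (λ y → (x * y) ≈ 1#)

CharNot2 : ∀ {c ℓ} → Field c ℓ → Set ℓ
CharNot2 F = ¬ ((Field._+_ F (Field.1# F) (Field.1# F)) ≈ Field.0# F)
  where open Field F using (_≈_)

module Ext {c₁ ℓ₁ c₂ ℓ₂} (K : Field c₁ ℓ₁) (L : Field c₂ ℓ₂) where
  private
    module K = Field K
    module L = Field L

  -- A unital ring homomorphism K → L (the structure map making L an extension of K).
  record IsRingHom (ι : K.Carrier → L.Carrier) : Set (c₁ ⊔ ℓ₁ ⊔ ℓ₂) where
    field
      cong  : ∀ {a b} → a K.≈ b → ι a L.≈ ι b
      hom+  : ∀ a b → ι (a K.+ b) L.≈ (ι a L.+ ι b)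
      hom*  : ∀ a b → ι (a K.* b) L.≈ (ι a L.* ι b)
      hom1  : ι K.1# L.≈ L.1#

  module _ (ι : K.Carrier → L.Carrier) where

    lincomb : ∀ {n} → (Fin n → K.Carrier) → (Fin n → L.Carrier) → L.Carrier
    lincomb c e = sumFin L.commRing (λ i → ι (c i) L.* e i)

    record IsBasis {n : ℕ} (e : Fin n → L.Carrier) : Set (c₁ ⊔ ℓ₁ ⊔ c₂ ⊔ ℓ₂) where
      field
        spans : ∀ x → Σ (Fin n → K.Carrier) (λ a → x L.≈ lincomb a e)
        indep : ∀ (a : Fin n → K.Carrier) → lincomb a e L.≈ L.0# → ∀ i → a i K.≈ K.0#

    record IsKAut (τ : L.Carrier → L.Carrier) : Set (c₁ ⊔ c₂ ⊔ ℓ₂) where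
      field
        cong  : ∀ {x y} → x L.≈ y → τ x L.≈ τ y
        hom+  : ∀ x y → τ (x L.+ y) L.≈ (τ x L.+ τ y)
        hom*  : ∀ x y → τ (x L.* y) L.≈ (τ x L.* τ y)
        hom1  : τ L.1# L.≈ L.1#
        surj  : ∀ y → Σ L.Carrier (λ x → τ x L.≈ y)
        fixK  : ∀ a → τ (ι a) L.≈ ι a

    _≗L_ : (L.Carrier → L.Carrier) → (L.Carrier → L.Carrier) → Set (c₂ ⊔ ℓ₂)
    f ≗L g = ∀ x → f x L.≈ g x

    -- The enumeration of G = {1, σ₁,…,σₘ, σ₁⁻¹,…,σₘ⁻¹} indexed by Fin (1 + (m + m)):
    -- index 0 ↦ 1, index 1+i ↦ σ_{i+1}, index 1+m+i ↦ σ_{i+1}⁻¹.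
    enum : ∀ {m} → (Fin m → L.Carrier → L.Carrier) → (Fin m → L.Carrier → L.Carrier)
         → Fin (suc (m +ℕ m)) → L.Carrier → L.Carrier
    enum s t zero x = x
    enum {m} s t (suc k) x with splitAt m k
    ... | inj₁ i = s i x
    ... | inj₂ i = t i x

    -- L/K is Galois of degree n = 2m+1 with Galois group G = Aut(L/K) equal to
    -- {1, σ₁,…,σₘ, σ₁⁻¹,…,σₘ⁻¹} (listed without repetition), where σ = s and σ⁻¹ = t.
    record IsGaloisGroupEnum (m : ℕ) (s t : Fin m → L.Carrier → L.Carrier)
           : Set (Level.suc (c₁ ⊔ ℓ₁ ⊔ c₂ ⊔ ℓ₂)) where
      field
        degree   : Σ (Fin (suc (m +ℕ m)) → L.Carrier) IsBasis
        s-aut    : ∀ i → IsKAut (s i)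
        t-aut    : ∀ i → IsKAut (t i)
        st-inv   : ∀ i x → s i (t i x) L.≈ x
        ts-inv   : ∀ i x → t i (s i x) L.≈ x
        distinct : ∀ j k → enum s t j ≗L enum s t k → j ≡ k
        complete : ∀ τ → IsKAut τ → ∃ λ k → τ ≗L enum s t k

  record SymForm (ι : K.Carrier → L.Carrier) : Set (c₁ ⊔ ℓ₁ ⊔ c₂ ⊔ ℓ₂) where
    field
      B      : L.Carrier → L.Carrier → K.Carrier
      cong   : ∀ {x x' y y'} → x L.≈ x' → y L.≈ y' → B x y K.≈ B x' y'
      linear : ∀ a x x' y → B ((ι a L.* x) L.+ x') y K.≈ ((a K.* B x y) K.+ B x' y)
      symm   : ∀ x y → B x y K.≈ B y x

  module _ (ι : K.Carrier → L.Carrier) {m : ℕ} (s t : Fin m → L.Carrier → L.Carrier) where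

    -- tr^L_K(a) = Σ_{τ ∈ G} τ(a)   (an element of L lying in ι(K))
    tr : L.Carrier → L.Carrier
    tr a = sumFin L.commRing (λ k → enum ι s t k a)

    -- σ₀ = 1, σ_i = s (i-1) for 1 ≤ i ≤ m
    σ : Fin (suc m) → L.Carrier → L.Carrier
    σ zero    x = x
    σ (suc i) x = s i x

    Represents : L.Carrier → (L.Carrier → L.Carrier) → SymForm ι → Set (c₂ ⊔ ℓ₂)
    Represents b τ F = ∀ x y → ι (SymForm.B F x y) L.≈ tr (b L.* ((x L.* τ y) L.+ (τ x L.* y)))

    InA : Fin (suc m) → SymForm ι → Set (c₂ ⊔ ℓ₂)
    InA i F = Σ L.Carrier (λ b → Represents b (σ i) F)

{-# OPTIONS --safe #-}

-- By Dedekind's lemma the n elements χₖ of G are L-linearly independent, so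
-- End_K(L) = L[G] and the trace form (x, y) ↦ tr(xy) is non-degenerate. Hence a
-- symmetric form B is tr(h(x)·y) for a unique h = Σ cₖχₖ ∈ L[G], and symmetry of B
-- says h is self-adjoint: cₖ = χₖ(c_{k⁻¹}). On the other side Σᵢ φ_{bᵢ,σᵢ} corresponds
-- to the self-adjoint element with coefficient 2b₀ at 1, bᵢ at σᵢ and σᵢ⁻¹(bᵢ) at σᵢ⁻¹.
-- As n is odd no σᵢ is an involution, so every self-adjoint element arises from a
-- unique (bᵢ) (2 is invertible), which is the direct sum decomposition. For i ≥ 1,
-- φ_{b,σᵢ}(x, ·) = tr((σᵢ⁻¹(bx) + bσᵢ(x))·_) vanishes only if σᵢ⁻¹(bx) = −bσᵢ(x);
-- taking norms, N(b)N(x) = (−1)ⁿN(b)N(x) = −N(b)N(x), forcing b = 0 or x = 0.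
--
-- Constructively, Dedekind's argument only gives independence up to double
-- negation. A nonvanishing determinant upgrades it to an honest left inverse of
-- the matrix (χₖ(e_j)), which also yields the trace-dual basis and the K-valued trace.

module Submission where

open import Defs
open import Level using (_⊔_)
open import Data.Nat using (ℕ; zero; suc)
open import Data.Fin using (Fin; zero; suc)
open import Data.Product using (Σ; _×_; _,_)
open import Relation.Nullary using (¬_)

open import Data.Nat using () renaming (_+_ to _+ℕ_)
open import Data.Fin using (punchIn; punchOut; splitAt; _↑ˡ_; _↑ʳ_)
open import Data.Fin.Properties
  using (punchIn-punchOut; punchInᵢ≢i; suc-injective; splitAt-↑ˡ; splitAt-↑ʳ; ∀-cons; any?)
  renaming (_≟_ to _≟ᶠ_)
open import Data.Fin.Permutation using (permutation)
open import Data.Sum using (inj₁; inj₂; [_,_]′)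
open import Data.Product using (proj₁; proj₂)
open import Data.Vec.Functional using (_∷_; updateAt)
open import Data.Vec.Functional.Properties using (updateAt-updates; updateAt-minimal)
open import Function using (_∘_)
open import Relation.Nullary using (yes; no; contradiction)
open import Relation.Binary.PropositionalEquality as ≡ using (_≡_; _≢_)
open import Algebra.Bundles using (CommutativeMonoid; CommutativeRing)
import Algebra.Properties.CommutativeMonoid.Sum as CommutativeMonoidSum
import Algebra.Properties.CommutativeSemigroup as CommutativeSemigroupProperties
import Algebra.Properties.Ring as RingProperties
import Algebra.Properties.Semiring.Sum as SemiringSum
import Algebra.Solver.CommutativeMonoid as CommutativeMonoidSolver
import Relation.Binary.Reasoning.Setoid as SetoidReasoning

module FinSum {c ℓ} (M : CommutativeMonoid c ℓ) where
  open CommutativeMonoid M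
  open CommutativeMonoidSum M public

  sum-identity : ∀ {n} {f : Fin n → Carrier} → (∀ i → f i ≈ ε) → sum f ≈ ε
  sum-identity {n} f≈ε = trans (sum-cong-≋ f≈ε) (sum-replicate-zero n)

  sum-extract : ∀ {n} (f : Fin (suc n) → Carrier) a → (∀ i → f (punchIn a i) ≈ ε) → sum f ≈ f a
  sum-extract f a rest≈ε =
    trans (sum-remove {i = a} f) (trans (∙-congˡ (sum-identity rest≈ε)) (identityʳ (f a)))

  sum-↑ : ∀ m n (f : Fin (m +ℕ n) → Carrier) →
          sum f ≈ sum (λ i → f (i ↑ˡ n)) ∙ sum (λ i → f (m ↑ʳ i))
  sum-↑ zero    n f = sym (identityˡ _)
  sum-↑ (suc m) n f = trans (∙-congˡ (sum-↑ m n (λ i → f (suc i)))) (sym (assoc _ _ _))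

  sum-reindex : ∀ {n} (f : Fin n → Carrier) (π π⁻¹ : Fin n → Fin n) →
                (∀ k → π (π⁻¹ k) ≡ k) → (∀ k → π⁻¹ (π k) ≡ k) → sum (λ k → f (π k)) ≈ sum f
  sum-reindex f π π⁻¹ ππ⁻¹ π⁻¹π = sym (sum-permute f (permutation π π⁻¹ ππ⁻¹ π⁻¹π))

module CommutativeRingProperties {c ℓ} (R : CommutativeRing c ℓ) where
  open CommutativeRing R hiding (zero)
  open FinSum +-commutativeMonoid public
  open SemiringSum semiring public using (*-distribˡ-sum; *-distribʳ-sum)
  open RingProperties ring using (-0#≈0#; -‿+-comm; +-cancelˡ; -‿involutive; -‿distribˡ-*; -‿distribʳ-*)
  open SetoidReasoning setoid

  -x*-y≈x*y : ∀ x y → - x * - y ≈ x * y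
  -x*-y≈x*y x y = trans (sym (-‿distribˡ-* x (- y))) (trans (-‿cong (sym (-‿distribʳ-* x y))) (-‿involutive _))

  x≈0⇒x*y≈0 : ∀ {x} y → x ≈ 0# → x * y ≈ 0#
  x≈0⇒x*y≈0 y x≈0 = trans (*-congʳ x≈0) (zeroˡ y)

  y≈0⇒x*y≈0 : ∀ x {y} → y ≈ 0# → x * y ≈ 0#
  y≈0⇒x*y≈0 x y≈0 = trans (*-congˡ y≈0) (zeroʳ x)

  sumFin≡sum : ∀ {n} (f : Fin n → Carrier) → sumFin R f ≡ sum f
  sumFin≡sum {zero}  f = ≡.refl
  sumFin≡sum {suc n} f = ≡.cong (f zero +_) (sumFin≡sum (λ i → f (suc i)))

  sum-neg : ∀ {n} (f : Fin n → Carrier) → sum (λ i → - f i) ≈ - sum f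
  sum-neg {zero}  f = sym -0#≈0#
  sum-neg {suc n} f = trans (+-congˡ (sum-neg (λ i → f (suc i)))) (-‿+-comm _ _)

  sum-sub : ∀ {n} (f g : Fin n → Carrier) → sum (λ i → f i - g i) ≈ sum f - sum g
  sum-sub f g = trans (∑-distrib-+ f (λ i → - g i)) (+-congˡ (sum-neg g))

  sum-offDiagonal-transpose : ∀ {n} (H : Fin (suc n) → Fin (suc n) → Carrier) →
    sum (λ a → sum (λ i → H a (punchIn a i))) ≈ sum (λ b → sum (λ i → H (punchIn b i) b))
  sum-offDiagonal-transpose H = +-cancelˡ (sum (λ a → H a a)) _ _ (begin
    sum (λ a → H a a) + sum (λ a → sum (λ i → H a (punchIn a i)))
      ≈⟨ ∑-distrib-+ (λ a → H a a) (λ a → sum (λ i → H a (punchIn a i))) ⟨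
    sum (λ a → H a a + sum (λ i → H a (punchIn a i)))
      ≈⟨ sum-cong-≋ (λ a → sum-remove {i = a} (H a)) ⟨
    sum (λ a → sum (λ b → H a b))
      ≈⟨ ∑-comm H ⟩
    sum (λ b → sum (λ a → H a b))
      ≈⟨ sum-cong-≋ (λ b → sum-remove {i = b} (λ a → H a b)) ⟩
    sum (λ b → H b b + sum (λ i → H (punchIn b i) b))
      ≈⟨ ∑-distrib-+ (λ b → H b b) (λ b → sum (λ i → H (punchIn b i) b)) ⟩
    sum (λ b → H b b) + sum (λ b → sum (λ i → H (punchIn b i) b)) ∎)

module AdditiveHomomorphism {c₁ ℓ₁ c₂ ℓ₂} (R : CommutativeRing c₁ ℓ₁) (S : CommutativeRing c₂ ℓ₂)
  (f : CommutativeRing.Carrier R → CommutativeRing.Carrier S)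
  (f-cong : ∀ {x y} → CommutativeRing._≈_ R x y → CommutativeRing._≈_ S (f x) (f y))
  (+-homo : ∀ x y → CommutativeRing._≈_ S (f (CommutativeRing._+_ R x y)) (CommutativeRing._+_ S (f x) (f y)))
  where
  private
    module R = CommutativeRing R
    module ΣR = CommutativeRingProperties R
    module ΣS = CommutativeRingProperties S
  open CommutativeRing S
  open RingProperties (CommutativeRing.ring S) using (+-cancelˡ; +-inverseʳ-unique)

  0#-homo : f R.0# ≈ 0#
  0#-homo = +-cancelˡ (f R.0#) _ _
    (trans (sym (+-homo R.0# R.0#)) (trans (f-cong (R.+-identityʳ R.0#)) (sym (+-identityʳ _))))

  -‿homo : ∀ x → f (R.- x) ≈ - f x
  -‿homo x = +-inverseʳ-unique (f x) (f (R.- x))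
    (trans (sym (+-homo x (R.- x))) (trans (f-cong (R.-‿inverseʳ x)) 0#-homo))

  sub-homo : ∀ x y → f (x R.- y) ≈ f x - f y
  sub-homo x y = trans (+-homo x (R.- y)) (+-congˡ (-‿homo y))

  sum-homo : ∀ {n} (g : Fin n → R.Carrier) → f (ΣR.sum g) ≈ ΣS.sum (λ i → f (g i))
  sum-homo {zero}  g = 0#-homo
  sum-homo {suc n} g = trans (+-homo _ _) (+-congˡ (sum-homo (λ i → g (suc i))))

module Determinant {c ℓ} (R : CommutativeRing c ℓ) where
  open CommutativeRing R hiding (zero)
  open CommutativeRingProperties R
  open RingProperties ring using (-‿involutive; -‿distribˡ-*; +-inverseʳ-unique; -0#≈0#)
  open CommutativeMonoidSolver *-commutativeMonoid using (solve; _⊕_; _⊜_)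
  open CommutativeSemigroupProperties *-commutativeSemigroup using (x∙yz≈y∙xz)
  open SetoidReasoning setoid

  Matrix : ℕ → ℕ → Set c
  Matrix m n = Fin m → Fin n → Carrier

  columns : ∀ {m n k} → Matrix m n → (Fin k → Fin n) → Matrix m k
  columns A f r c = A r (f c)

  sign : ∀ {n} → Fin n → Carrier
  sign zero    = 1#
  sign (suc i) = - sign i

  sign²≈1 : ∀ {n} (i : Fin n) → sign i * sign i ≈ 1#
  sign²≈1 zero    = *-identityˡ 1#
  sign²≈1 (suc i) = trans (-x*-y≈x*y _ _) (sign²≈1 i)

  minor : ∀ {n} → Matrix (suc n) (suc n) → Fin (suc n) → Matrix n n
  minor A i r c = A (punchIn i r) (suc c)

  det : ∀ {n} → Matrix n n → Carrier
  det {zero}  A = 1#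
  det {suc n} A = sum (λ i → sign i * A i zero * det (minor A i))

  det-cong : ∀ {n} {A B : Matrix n n} → (∀ r c → A r c ≈ B r c) → det A ≈ det B
  det-cong {zero}  A≈B = refl
  det-cong {suc n} A≈B = sum-cong-≋ (λ i →
    *-cong (*-congˡ {sign i} (A≈B i zero)) (det-cong (λ r c → A≈B (punchIn i r) (suc c))))

  -- squeeze a b is the position of row b once row a is deleted (junk when a ≡ b).
  squeeze : ∀ {n} → Fin (suc (suc n)) → Fin (suc (suc n)) → Fin (suc n)
  squeeze zero    zero    = zero
  squeeze zero    (suc b) = b
  squeeze (suc a) zero    = zero
  squeeze {zero}  (suc a) (suc b) = zero
  squeeze {suc n} (suc a) (suc b) = suc (squeeze a b)

  squeeze-punchIn : ∀ {n} (a : Fin (suc (suc n))) i → squeeze a (punchIn a i) ≡ i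
  squeeze-punchIn zero    i       = ≡.refl
  squeeze-punchIn (suc a) zero    = ≡.refl
  squeeze-punchIn {suc n} (suc a) (suc i) = ≡.cong suc (squeeze-punchIn a i)

  punchIn-squeeze-comm : ∀ {n} {a b : Fin (suc (suc n))} → a ≢ b → ∀ r →
    punchIn a (punchIn (squeeze a b) r) ≡ punchIn b (punchIn (squeeze b a) r)
  punchIn-squeeze-comm {a = zero}  {zero}  a≢b r = contradiction ≡.refl a≢b
  punchIn-squeeze-comm {a = zero}  {suc b} a≢b r = ≡.refl
  punchIn-squeeze-comm {a = suc a} {zero}  a≢b r = ≡.refl
  punchIn-squeeze-comm {zero} {suc zero} {suc zero} a≢b r = contradiction ≡.refl a≢b
  punchIn-squeeze-comm {suc n} {suc a} {suc b} a≢b zero    = ≡.refl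
  punchIn-squeeze-comm {suc n} {suc a} {suc b} a≢b (suc r) =
    ≡.cong suc (punchIn-squeeze-comm (λ a≡b → a≢b (≡.cong suc a≡b)) r)

  sign-squeeze-antisym : ∀ {n} {a b : Fin (suc (suc n))} → a ≢ b →
    sign a * sign (squeeze a b) ≈ - (sign b * sign (squeeze b a))
  sign-squeeze-antisym {a = zero}  {zero}  a≢b = contradiction ≡.refl a≢b
  sign-squeeze-antisym {a = zero}  {suc b} a≢b =
    trans (*-identityˡ _) (sym (trans (-‿cong (*-identityʳ _)) (-‿involutive _)))
  sign-squeeze-antisym {a = suc a} {zero}  a≢b = trans (*-identityʳ _) (-‿cong (sym (*-identityˡ _)))
  sign-squeeze-antisym {zero} {suc zero} {suc zero} a≢b = contradiction ≡.refl a≢b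
  sign-squeeze-antisym {suc n} {suc a} {suc b} a≢b = begin
    - sign a * - sign (squeeze a b)   ≈⟨ -x*-y≈x*y _ _ ⟩
    sign a * sign (squeeze a b)       ≈⟨ sign-squeeze-antisym (λ a≡b → a≢b (≡.cong suc a≡b)) ⟩
    - (sign b * sign (squeeze b a))   ≈⟨ -‿cong (-x*-y≈x*y _ _) ⟨
    - (- sign b * - sign (squeeze b a)) ∎

  swap₀₁ : ∀ {n} → Fin (suc (suc n)) → Fin (suc (suc n))
  swap₀₁ zero          = suc zero
  swap₀₁ (suc zero)    = zero
  swap₀₁ (suc (suc c)) = suc (suc c)

  -- Term (a, b) of the Laplace expansion of det A along its first two columns.
  expansion₂ : ∀ {n} → Matrix (suc (suc n)) (suc (suc n)) → Fin (suc (suc n)) → Fin (suc (suc n)) → Carrier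
  expansion₂ A a b = sign a * sign (squeeze a b) * A a zero * A b (suc zero)
    * det (λ r c → A (punchIn a (punchIn (squeeze a b) r)) (suc (suc c)))

  det-expand₂ : ∀ {n} (A : Matrix (suc (suc n)) (suc (suc n))) →
    det A ≈ sum (λ a → sum (λ i → expansion₂ A a (punchIn a i)))
  det-expand₂ A = sum-cong-≋ λ a → begin
    sign a * A a zero * det (minor A a)
      ≈⟨ *-distribˡ-sum (sign a * A a zero)
           (λ i → sign i * A (punchIn a i) (suc zero) * det (minor (minor A a) i)) ⟩
    sum (λ i → sign a * A a zero * (sign i * A (punchIn a i) (suc zero) * det (minor (minor A a) i)))
      ≈⟨ sum-cong-≋ (λ i → trans (reorder _ _ _ _ _) (reflexive (≡.sym (term a i)))) ⟩
    sum (λ i → expansion₂ A a (punchIn a i)) ∎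
    where
    reorder : ∀ s a t b d → s * a * (t * b * d) ≈ s * t * a * b * d
    reorder = solve 5 (λ s a t b d → (s ⊕ a) ⊕ ((t ⊕ b) ⊕ d) ⊜ (((s ⊕ t) ⊕ a) ⊕ b) ⊕ d) refl
    term : ∀ a i → expansion₂ A a (punchIn a i)
                 ≡ sign a * sign i * A a zero * A (punchIn a i) (suc zero) * det (minor (minor A a) i)
    term a i rewrite squeeze-punchIn a i = ≡.refl

  expansion₂-swap : ∀ {n} (A : Matrix (suc (suc n)) (suc (suc n))) {a b} → a ≢ b →
    expansion₂ (columns A swap₀₁) b a ≈ - expansion₂ A a b
  expansion₂-swap A {a} {b} a≢b = begin
    sign b * sign (squeeze b a) * A b (suc zero) * A a zero * D b a
      ≈⟨ *-cong (*-congʳ (*-congʳ (sign-squeeze-antisym (≡.≢-sym a≢b)))) D-sym ⟩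
    - (sign a * sign (squeeze a b)) * A b (suc zero) * A a zero * D a b
      ≈⟨ negate-swap _ _ _ _ ⟩
    - expansion₂ A a b ∎
    where
    D : _ → _ → Carrier
    D a b = det (λ r c → A (punchIn a (punchIn (squeeze a b) r)) (suc (suc c)))
    D-sym : D b a ≈ D a b
    D-sym = det-cong (λ r c → reflexive (≡.cong (λ z → A z (suc (suc c))) (≡.sym (punchIn-squeeze-comm a≢b r))))
    negate-swap : ∀ s x y d → - s * x * y * d ≈ - (s * y * x * d)
    negate-swap s x y d = trans (*-congʳ (*-congʳ (sym (-‿distribˡ-* s x))))
      (trans (*-congʳ (sym (-‿distribˡ-* (s * x) y))) (trans (sym (-‿distribˡ-* _ d))
      (-‿cong (solve 4 (λ s x y d → ((s ⊕ x) ⊕ y) ⊕ d ⊜ ((s ⊕ y) ⊕ x) ⊕ d) refl s x y d))))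

  det-swap₀₁ : ∀ {n} (A : Matrix (suc (suc n)) (suc (suc n))) → det (columns A swap₀₁) ≈ - det A
  det-swap₀₁ A = +-inverseʳ-unique (det A) _ (begin
    det A + det A′          ≈⟨ +-cong (det-expand₂ A) (trans (det-expand₂ A′) (sum-offDiagonal-transpose (expansion₂ A′))) ⟩
    sum T + sum T′          ≈⟨ ∑-distrib-+ T T′ ⟨
    sum (λ a → T a + T′ a)  ≈⟨ sum-identity (λ a → trans (sym (∑-distrib-+ (term a) (term′ a))) (sum-identity (cancel a))) ⟩
    0#                      ∎)
    where
    A′ = columns A swap₀₁
    term term′ : ∀ a → Fin _ → Carrier
    term  a i = expansion₂ A a (punchIn a i)
    term′ a i = expansion₂ A′ (punchIn a i) a
    T T′ : Fin _ → Carrier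
    T  a = sum (term a)
    T′ a = sum (term′ a)
    cancel : ∀ a i → term a i + term′ a i ≈ 0#
    cancel a i = trans (+-congˡ (expansion₂-swap A (≡.≢-sym (punchInᵢ≢i a i)))) (-‿inverseʳ _)

  det-moveToFront : ∀ {n} (A : Matrix (suc n) (suc n)) j →
    det (columns A (j ∷ punchIn j)) ≈ sign j * det A
  det-moveToFront A zero = trans (det-cong same) (sym (*-identityˡ _))
    where
    same : ∀ r c → columns A (zero ∷ punchIn zero) r c ≈ A r c
    same r zero    = refl
    same r (suc c) = refl
  det-moveToFront {suc n} A (suc j) = begin
    det A′
      ≈⟨ -‿involutive (det A′) ⟨
    - - det A′
      ≈⟨ -‿cong (det-swap₀₁ A′) ⟨
    - det (columns A′ swap₀₁)
      ≈⟨ -‿cong (det-cong same) ⟩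
    - sum (λ i → sign i * A i zero * det (columns (minor A i) (j ∷ punchIn j)))
      ≈⟨ -‿cong (sum-cong-≋ (λ i → *-congˡ {sign i * A i zero} (det-moveToFront (minor A i) j))) ⟩
    - sum (λ i → sign i * A i zero * (sign j * det (minor A i)))
      ≈⟨ -‿cong (sum-cong-≋ (λ i → x∙yz≈y∙xz (sign i * A i zero) (sign j) (det (minor A i)))) ⟩
    - sum (λ i → sign j * (sign i * A i zero * det (minor A i)))
      ≈⟨ -‿cong (*-distribˡ-sum (sign j) (λ i → sign i * A i zero * det (minor A i))) ⟨
    - (sign j * det A)
      ≈⟨ -‿distribˡ-* (sign j) (det A) ⟩
    - sign j * det A ∎
    where
    A′ = columns A (suc j ∷ punchIn (suc j))
    same : ∀ r c → columns A′ swap₀₁ r c ≈ columns A (zero ∷ (λ c → suc ((j ∷ punchIn j) c))) r c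
    same r zero          = refl
    same r (suc zero)    = refl
    same r (suc (suc c)) = refl

  adjugate : ∀ {n} → Matrix (suc n) (suc n) → Matrix (suc n) (suc n)
  adjugate A j i = sign j * (sign i * det (λ r c → A (punchIn i r) (punchIn j c)))

  adjugate-mul : ∀ {n} (A : Matrix (suc n) (suc n)) j k →
    sum (λ i → adjugate A j i * A i k) ≈ sign j * det (columns A (k ∷ punchIn j))
  adjugate-mul A j k = begin
    sum (λ i → sign j * (sign i * D i) * A i k)  ≈⟨ sum-cong-≋ (λ i → reorder (sign j) (sign i) (D i) (A i k)) ⟩
    sum (λ i → sign j * (sign i * A i k * D i))  ≈⟨ *-distribˡ-sum (sign j) (λ i → sign i * A i k * D i) ⟨
    sign j * det (columns A (k ∷ punchIn j))     ∎
    where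
    D : _ → Carrier
    D i = det (λ r c → A (punchIn i r) (punchIn j c))
    reorder : ∀ s t d a → s * (t * d) * a ≈ s * (t * a * d)
    reorder = solve 4 (λ s t d a → (s ⊕ (t ⊕ d)) ⊕ a ⊜ s ⊕ ((t ⊕ a) ⊕ d)) refl

  adjugate-mul-diagonal : ∀ {n} (A : Matrix (suc n) (suc n)) j → sum (λ i → adjugate A j i * A i j) ≈ det A
  adjugate-mul-diagonal A j = begin
    sum (λ i → adjugate A j i * A i j)          ≈⟨ adjugate-mul A j j ⟩
    sign j * det (columns A (j ∷ punchIn j))    ≈⟨ *-congˡ (det-moveToFront A j) ⟩
    sign j * (sign j * det A)                   ≈⟨ *-assoc _ _ _ ⟨
    sign j * sign j * det A                     ≈⟨ *-congʳ (sign²≈1 j) ⟩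
    1# * det A                                  ≈⟨ *-identityˡ _ ⟩
    det A                                       ∎

  -- A repeated column gives det A = - det A, hence det A = 0 once doubling is injective.
  module Alternating (double-injective : ∀ x → x + x ≈ 0# → x ≈ 0#) where

    det-repeatedColumn : ∀ {n} (A : Matrix (suc n) (suc n)) q → (∀ r → A r zero ≈ A r (suc q)) → det A ≈ 0#
    det-repeatedColumn {suc n} A zero same = double-injective (det A) (begin
      det A + det A                    ≈⟨ +-congʳ (det-cong swapped) ⟨
      det (columns A swap₀₁) + det A   ≈⟨ +-congʳ (det-swap₀₁ A) ⟩
      - det A + det A                  ≈⟨ -‿inverseˡ (det A) ⟩
      0#                               ∎)
      where
      swapped : ∀ r c → columns A swap₀₁ r c ≈ A r c
      swapped r zero          = sym (same r)
      swapped r (suc zero)    = same r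
      swapped r (suc (suc c)) = refl
    det-repeatedColumn {suc n} A (suc q) same = begin
      det A                     ≈⟨ -‿involutive (det A) ⟨
      - - det A                 ≈⟨ -‿cong (det-swap₀₁ A) ⟨
      - det (columns A swap₀₁)  ≈⟨ -‿cong (sum-identity (λ i → y≈0⇒x*y≈0 (sign i * columns A swap₀₁ i zero)
                                      (det-repeatedColumn (minor (columns A swap₀₁) i) q (λ r → same (punchIn i r))))) ⟩
      - 0#                      ≈⟨ -0#≈0# ⟩
      0#                        ∎

    det-columns : ∀ {k} (f : Fin k → Fin k) → Σ Carrier λ ε → ∀ A → det (columns A f) ≈ ε * det A
    det-columns {zero}  f = 1# , λ A → sym (*-identityˡ 1#)
    det-columns {suc k} f with any? (λ q → f (suc q) ≟ᶠ f zero)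
    ... | yes (q , f[1+q]≡f0) = 0# , λ A → trans
      (det-repeatedColumn (columns A f) q (λ r → reflexive (≡.cong (A r) (≡.sym f[1+q]≡f0))))
      (sym (zeroˡ _))
    ... | no f0-unrepeated = ε * sign (f zero) , expand
      where
      f0≢f[1+c] : ∀ c → f zero ≢ f (suc c)
      f0≢f[1+c] c f0≡f[1+c] = f0-unrepeated (c , ≡.sym f0≡f[1+c])
      f′ : Fin k → Fin k
      f′ c = punchOut (f0≢f[1+c] c)
      ε : Carrier
      ε = proj₁ (det-columns f′)
      A∖ : Matrix (suc k) (suc k) → Fin (suc k) → Matrix k k
      A∖ A i r c = A (punchIn i r) (punchIn (f zero) c)

      expand : ∀ A → det (columns A f) ≈ ε * sign (f zero) * det A
      expand A = begin
        det (columns A f)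
          ≈⟨ sum-cong-≋ (λ i → *-congˡ {sign i * A i (f zero)}
               (det-cong (λ r c → reflexive (≡.cong (A (punchIn i r)) (≡.sym (punchIn-punchOut (f0≢f[1+c] c))))))) ⟩
        sum (λ i → sign i * A i (f zero) * det (columns (A∖ A i) f′))
          ≈⟨ sum-cong-≋ (λ i → *-congˡ {sign i * A i (f zero)} (proj₂ (det-columns f′) (A∖ A i))) ⟩
        sum (λ i → sign i * A i (f zero) * (ε * det (A∖ A i)))
          ≈⟨ sum-cong-≋ (λ i → x∙yz≈y∙xz (sign i * A i (f zero)) ε (det (A∖ A i))) ⟩
        sum (λ i → ε * (sign i * A i (f zero) * det (A∖ A i)))
          ≈⟨ *-distribˡ-sum ε (λ i → sign i * A i (f zero) * det (A∖ A i)) ⟨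
        ε * det (columns A (f zero ∷ punchIn (f zero)))
          ≈⟨ *-congˡ (det-moveToFront A (f zero)) ⟩
        ε * (sign (f zero) * det A)
          ≈⟨ *-assoc _ _ _ ⟨
        ε * sign (f zero) * det A ∎

    adjugate-mul-offDiagonal : ∀ {n} (A : Matrix (suc n) (suc n)) {j k} → j ≢ k →
      sum (λ i → adjugate A j i * A i k) ≈ 0#
    adjugate-mul-offDiagonal A j≢k = trans (adjugate-mul A _ _) (y≈0⇒x*y≈0 _
      (det-repeatedColumn (columns A (_ ∷ punchIn _)) (punchOut j≢k)
        (λ r → reflexive (≡.cong (A r) (≡.sym (punchIn-punchOut j≢k))))))

¬¬-∀ : ∀ {n p} {P : Fin n → Set p} → (∀ i → ¬ ¬ P i) → ¬ ¬ (∀ i → P i)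
¬¬-∀ {zero}  ¬¬P ¬∀P = ¬∀P (λ ())
¬¬-∀ {suc n} ¬¬P ¬∀P = ¬¬P zero λ P₀ → ¬¬-∀ (λ i → ¬¬P (suc i)) λ P₊ → ¬∀P (∀-cons P₀ P₊)

module FieldLinearAlgebra {c ℓ} (F : Field c ℓ) (char≢2 : CharNot2 F) where
  open Field F hiding (zero)
  open CommutativeRingProperties commRing
  open Determinant commRing public
  open CommutativeSemigroupProperties *-commutativeSemigroup using (xy∙z≈xz∙y)
  open SetoidReasoning setoid

  ½ : Carrier
  ½ = proj₁ (inverse (1# + 1#) char≢2)

  ½x+½x≈x : ∀ x → ½ * x + ½ * x ≈ x
  ½x+½x≈x x = begin
    ½ * x + ½ * x       ≈⟨ distribʳ x ½ ½ ⟨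
    (½ + ½) * x         ≈⟨ *-congʳ (trans (distribˡ ½ 1# 1#) (+-cong (*-identityʳ ½) (*-identityʳ ½))) ⟨
    ½ * (1# + 1#) * x   ≈⟨ *-congʳ (trans (*-comm _ _) (proj₂ (inverse (1# + 1#) char≢2))) ⟩
    1# * x              ≈⟨ *-identityˡ x ⟩
    x                   ∎

  double-injective : ∀ x → x + x ≈ 0# → x ≈ 0#
  double-injective x x+x≈0 = trans (sym (½x+½x≈x x)) (trans (sym (distribˡ ½ x x)) (y≈0⇒x*y≈0 ½ x+x≈0))

  x≉0∧y≉0⇒x*y≉0 : ∀ {x y} → ¬ x ≈ 0# → ¬ y ≈ 0# → ¬ x * y ≈ 0#
  x≉0∧y≉0⇒x*y≉0 {x} {y} x≉0 y≉0 xy≈0 = y≉0 (begin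
    y              ≈⟨ *-identityˡ y ⟨
    1# * y         ≈⟨ *-congʳ (trans (*-comm _ _) (proj₂ (inverse x x≉0))) ⟨
    x⁻¹ * x * y    ≈⟨ *-assoc x⁻¹ x y ⟩
    x⁻¹ * (x * y)  ≈⟨ y≈0⇒x*y≈0 x⁻¹ xy≈0 ⟩
    0#             ∎)
    where x⁻¹ = proj₁ (inverse x x≉0)

  module Product = FinSum *-commutativeMonoid

  product-≉0 : ∀ {n} (f : Fin n → Carrier) → (∀ i → ¬ f i ≈ 0#) → ¬ Product.sum f ≈ 0#
  product-≉0 {zero}  f f≉0 = 1≉0
  product-≉0 {suc n} f f≉0 = x≉0∧y≉0⇒x*y≉0 (f≉0 zero) (product-≉0 (λ i → f (suc i)) (λ i → f≉0 (suc i)))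

  open Alternating double-injective public

  -- The rows of B are independent up to double negation: the form in which
  -- Dedekind's argument delivers independence without decidable equality.
  WeaklyIndependentRows : ∀ {k n} → Matrix k n → Set (c ⊔ ℓ)
  WeaklyIndependentRows {k} B = ∀ (v : Fin k → Carrier) → (∀ j → sum (λ i → v i * B i j) ≈ 0#) → ∀ i → ¬ ¬ (v i ≈ 0#)

  nonsingularColumns : ∀ {k n} (B : Matrix k n) → WeaklyIndependentRows B →
    ¬ ¬ Σ (Fin k → Fin n) λ f → ¬ det (columns B f) ≈ 0#
  nonsingularColumns {zero}  B indep none = none ((λ ()) , 1≉0)
  nonsingularColumns {suc k} B indep none = nonsingularColumns (λ r → B (suc r)) indep₊ extend
    where
    indep₊ : WeaklyIndependentRows (λ r → B (suc r))
    indep₊ v v·B≈0 i = indep (0# ∷ v)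
      (λ j → trans (+-cong (zeroˡ (B zero j)) (v·B≈0 j)) (+-identityˡ 0#)) (suc i)
    extend : ¬ Σ (Fin k → Fin _) λ g → ¬ det (columns (λ r → B (suc r)) g) ≈ 0#
    extend (g , det≉0) = ¬¬-∀ (λ j ≉0 → none (j ∷ g , λ ≈0 → ≉0 (trans (laplace j) ≈0)))
      λ cofactors·B≈0 → indep cofactors cofactors·B≈0 zero (λ ≈0 → det≉0 (trans (sym (*-identityˡ _)) ≈0))
      where
      cofactors : Fin (suc k) → Carrier
      cofactors i = sign i * det (λ r c → B (punchIn i r) (g c))
      laplace : ∀ j → sum (λ i → cofactors i * B i j) ≈ det (columns B (j ∷ g))
      laplace j = sum-cong-≋ (λ i → xy∙z≈xz∙y (sign i) (det (λ r c → B (punchIn i r) (g c))) (B i j))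

  det≉0 : ∀ {n} (A : Matrix n n) → WeaklyIndependentRows A → ¬ det A ≈ 0#
  det≉0 A indep detA≈0 = nonsingularColumns A indep λ (f , det≉0) →
    det≉0 (trans (proj₂ (det-columns f) A) (y≈0⇒x*y≈0 _ detA≈0))

  IsLeftInverse : ∀ {n} → Matrix n n → Matrix n n → Set ℓ
  IsLeftInverse W A = (∀ j → sum (λ i → W j i * A i j) ≈ 1#)
                    × (∀ j k → j ≢ k → sum (λ i → W j i * A i k) ≈ 0#)

  leftInverse : ∀ {n} (A : Matrix n n) → WeaklyIndependentRows A → Σ (Matrix n n) λ W → IsLeftInverse W A
  leftInverse {zero}  A indep = (λ ()) , (λ ()) , (λ ())
  leftInverse {suc n} A indep = W , diagonal , offDiagonal
    where
    d⁻¹ = proj₁ (inverse (det A) (det≉0 A indep))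
    W : Matrix (suc n) (suc n)
    W j i = d⁻¹ * adjugate A j i
    W·A : ∀ j k → sum (λ i → W j i * A i k) ≈ d⁻¹ * sum (λ i → adjugate A j i * A i k)
    W·A j k = trans (sum-cong-≋ (λ i → *-assoc d⁻¹ (adjugate A j i) (A i k)))
                    (sym (*-distribˡ-sum d⁻¹ (λ i → adjugate A j i * A i k)))
    diagonal : ∀ j → sum (λ i → W j i * A i j) ≈ 1#
    diagonal j = trans (W·A j j) (trans (*-congˡ (adjugate-mul-diagonal A j))
                   (trans (*-comm _ _) (proj₂ (inverse (det A) (det≉0 A indep)))))
    offDiagonal : ∀ j k → j ≢ k → sum (λ i → W j i * A i k) ≈ 0#
    offDiagonal j k j≢k = trans (W·A j k) (y≈0⇒x*y≈0 d⁻¹ (adjugate-mul-offDiagonal A j≢k))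

  leftInverse⇒injective : ∀ {n} {A W : Matrix n n} → IsLeftInverse W A → ∀ (v : Fin n → Carrier) →
    (∀ i → sum (λ b → A i b * v b) ≈ 0#) → ∀ a → v a ≈ 0#
  leftInverse⇒injective {zero}  _ v _ ()
  leftInverse⇒injective {suc n} {A} {W} (diagonal , offDiagonal) v A·v≈0 a = begin
    v a
      ≈⟨ *-identityˡ (v a) ⟨
    1# * v a
      ≈⟨ *-congʳ (diagonal a) ⟨
    W·A a a * v a
      ≈⟨ sum-extract (λ b → W·A a b * v b) a (λ i → x≈0⇒x*y≈0 _ (offDiagonal a _ (≡.≢-sym (punchInᵢ≢i a i)))) ⟨
    sum (λ b → W·A a b * v b)
      ≈⟨ sum-cong-≋ (λ b → *-distribʳ-sum (v b) (λ i → W a i * A i b)) ⟩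
    sum (λ b → sum (λ i → W a i * A i b * v b))
      ≈⟨ ∑-comm (λ b i → W a i * A i b * v b) ⟩
    sum (λ i → sum (λ b → W a i * A i b * v b))
      ≈⟨ sum-cong-≋ (λ i → trans (sum-cong-≋ (λ b → *-assoc (W a i) (A i b) (v b)))
                                  (sym (*-distribˡ-sum (W a i) (λ b → A i b * v b)))) ⟩
    sum (λ i → W a i * sum (λ b → A i b * v b))
      ≈⟨ sum-identity (λ i → y≈0⇒x*y≈0 (W a i) (A·v≈0 i)) ⟩
    0# ∎
    where
    W·A : Fin (suc n) → Fin (suc n) → Carrier
    W·A j k = sum (λ i → W j i * A i k)

  independentRows : ∀ {n} (A : Matrix n n) → WeaklyIndependentRows A →
    ∀ (v : Fin n → Carrier) → (∀ j → sum (λ i → v i * A i j) ≈ 0#) → ∀ i → v i ≈ 0#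
  independentRows A indep v v·A≈0 = leftInverse⇒injective (proj₂ (leftInverse Aᵀ indepᵀ)) v
    (λ j → trans (sum-cong-≋ (λ i → *-comm (A i j) (v i))) (v·A≈0 j))
    where
    Aᵀ : Matrix _ _
    Aᵀ j i = A i j
    columnsIndependent : ∀ (u : Fin _ → Carrier) → (∀ j → sum (λ i → A j i * u i) ≈ 0#) → ∀ i → u i ≈ 0#
    columnsIndependent = leftInverse⇒injective (proj₂ (leftInverse A indep))
    indepᵀ : WeaklyIndependentRows Aᵀ
    indepᵀ u u·Aᵀ≈0 i u≉0 = u≉0 (columnsIndependent u
      (λ j → trans (sum-cong-≋ (λ i → *-comm (A j i) (u i))) (u·Aᵀ≈0 j)) i)

module Galois {c₁ ℓ₁ c₂ ℓ₂} (K : Field c₁ ℓ₁) (L : Field c₂ ℓ₂) (char≢2 : CharNot2 K)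
  (ι : Field.Carrier K → Field.Carrier L) (ι-hom : Ext.IsRingHom K L ι)
  (m : ℕ) (s t : Fin m → Field.Carrier L → Field.Carrier L)
  (galois : Ext.IsGaloisGroupEnum K L ι m s t) where

  private
    module K = Field K
    module KR = RingProperties K.ring
    module ΣK = CommutativeRingProperties K.commRing
  open Field L hiding (zero)
  open CommutativeRingProperties commRing
  open Ext K L
  open IsRingHom ι-hom renaming (cong to ι-cong; hom+ to ι-+; hom* to ι-*; hom1 to ι-1)
  open IsGaloisGroupEnum galois
  open AdditiveHomomorphism K.commRing commRing ι ι-cong ι-+ using ()
    renaming (0#-homo to ι-0; sub-homo to ι-sub; sum-homo to ι-sum)
  open RingProperties ring
    using (x∙y⁻¹≈ε⇒x≈y; x≈y⇒x∙y⁻¹≈ε; x[y-z]≈xy-xz; [y-z]x≈yx-zx; +-inverseʳ-unique; -1*x≈-x)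
  open CommutativeSemigroupProperties *-commutativeSemigroup
  open SetoidReasoning setoid

  n : ℕ
  n = suc (m +ℕ m)

  χ : Fin n → Carrier → Carrier
  χ = enum ι s t

  e : Fin n → Carrier
  e = proj₁ degree
  open IsBasis (proj₂ degree)

  coordinates : Carrier → Fin n → K.Carrier
  coordinates y = proj₁ (spans y)

  expand-in-basis : ∀ y → y ≈ sum (λ j → ι (coordinates y j) * e j)
  expand-in-basis y = trans (proj₂ (spans y)) (reflexive (sumFin≡sum (λ j → ι (coordinates y j) * e j)))

  -- Constructively a field homomorphism is only ¬¬-injective; the independence
  -- of the basis gives injectivity outright.
  ι-injective : ∀ {u v} → ι u ≈ ι v → u K.≈ v
  ι-injective {u} {v} ιu≈ιv = KR.x∙y⁻¹≈ε⇒x≈y u v (indep a (begin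
    sumFin commRing (λ j → ι (a j) * e j)   ≡⟨ sumFin≡sum (λ j → ι (a j) * e j) ⟩
    ι (u K.- v) * e zero + sum (λ j → ι K.0# * e (suc j))
      ≈⟨ +-cong (x≈0⇒x*y≈0 (e zero) (trans (ι-sub u v) (x≈y⇒x∙y⁻¹≈ε ιu≈ιv)))
                (sum-identity (λ j → x≈0⇒x*y≈0 (e (suc j)) ι-0)) ⟩
    0# + 0#                                  ≈⟨ +-identityˡ 0# ⟩
    0#                                       ∎) zero)
    where
    a : Fin n → K.Carrier
    a = (u K.- v) ∷ (λ _ → K.0#)

  char≢2ᴸ : ¬ (1# + 1# ≈ 0#)
  char≢2ᴸ 2≈0 = char≢2 (ι-injective (begin
    ι (K.1# K.+ K.1#)  ≈⟨ ι-+ K.1# K.1# ⟩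
    ι K.1# + ι K.1#    ≈⟨ +-cong ι-1 ι-1 ⟩
    1# + 1#            ≈⟨ 2≈0 ⟩
    0#                 ≈⟨ ι-0 ⟨
    ι K.0#             ∎))

  open FieldLinearAlgebra L char≢2ᴸ

  module Automorphism {τ : Carrier → Carrier} (τ-aut : IsKAut ι τ) where
    open IsKAut τ-aut public
    open AdditiveHomomorphism commRing commRing τ cong hom+ public

    ι-linear : ∀ a x → τ (ι a * x) ≈ ι a * τ x
    ι-linear a x = trans (hom* (ι a) x) (*-congʳ (fixK a))

    expand-image : ∀ x → τ x ≈ sum (λ j → ι (coordinates x j) * τ (e j))
    expand-image x = begin
      τ x                                          ≈⟨ cong (expand-in-basis x) ⟩
      τ (sum (λ j → ι (coordinates x j) * e j))    ≈⟨ sum-homo (λ j → ι (coordinates x j) * e j) ⟩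
      sum (λ j → τ (ι (coordinates x j) * e j))    ≈⟨ sum-cong-≋ (λ j → ι-linear (coordinates x j) (e j)) ⟩
      sum (λ j → ι (coordinates x j) * τ (e j))    ∎

    ≉0-preserving : ∀ {x} → ¬ x ≈ 0# → ¬ τ x ≈ 0#
    ≉0-preserving {x} x≉0 τx≈0 = 1≉0 (begin
      1#              ≈⟨ hom1 ⟨
      τ 1#            ≈⟨ cong (proj₂ (inverse x x≉0)) ⟨
      τ (x * x⁻¹)     ≈⟨ hom* x x⁻¹ ⟩
      τ x * τ x⁻¹     ≈⟨ x≈0⇒x*y≈0 (τ x⁻¹) τx≈0 ⟩
      0#              ∎)
      where x⁻¹ = proj₁ (inverse x x≉0)

  automorphism-determinedOnBasis : ∀ {τ τ′ : Carrier → Carrier} → IsKAut ι τ → IsKAut ι τ′ →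
    (∀ j → τ (e j) ≈ τ′ (e j)) → ∀ x → τ x ≈ τ′ x
  automorphism-determinedOnBasis {τ} {τ′} τ-aut τ′-aut agree x = begin
    τ x                                          ≈⟨ Automorphism.expand-image τ-aut x ⟩
    sum (λ j → ι (coordinates x j) * τ (e j))    ≈⟨ sum-cong-≋ (λ j → *-congˡ {ι (coordinates x j)} (agree j)) ⟩
    sum (λ j → ι (coordinates x j) * τ′ (e j))   ≈⟨ Automorphism.expand-image τ′-aut x ⟨
    τ′ x                                         ∎

  id-aut : IsKAut ι (λ x → x)
  id-aut = record { cong = λ x≈y → x≈y ; hom+ = λ _ _ → refl ; hom* = λ _ _ → refl ; hom1 = refl
                  ; surj = λ y → y , refl ; fixK = λ _ → refl }

  χ-aut : ∀ k → IsKAut ι (χ k)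
  χ-aut zero = id-aut
  χ-aut (suc k) with splitAt m k
  ... | inj₁ i = s-aut i
  ... | inj₂ i = t-aut i

  sIdx tIdx : Fin m → Fin n
  sIdx i = suc (i ↑ˡ m)
  tIdx i = suc (m ↑ʳ i)

  χ-sIdx : ∀ i x → χ (sIdx i) x ≡ s i x
  χ-sIdx i x rewrite splitAt-↑ˡ m i m = ≡.refl

  χ-tIdx : ∀ i x → χ (tIdx i) x ≡ t i x
  χ-tIdx i x rewrite splitAt-↑ʳ m m i = ≡.refl

  sum-split-G : ∀ (f : Fin n → Carrier) → sum f ≈ f zero + (sum (λ i → f (sIdx i)) + sum (λ i → f (tIdx i)))
  sum-split-G f = +-congˡ (sum-↑ m m (λ k → f (suc k)))

  inv : Fin n → Fin n
  inv zero = zero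
  inv (suc k) with splitAt m k
  ... | inj₁ i = tIdx i
  ... | inj₂ i = sIdx i

  inv-tIdx : ∀ i → inv (tIdx i) ≡ sIdx i
  inv-tIdx i rewrite splitAt-↑ʳ m m i = ≡.refl

  χ-inverseˡ : ∀ a x → χ (inv a) (χ a x) ≈ x
  χ-inverseˡ zero x = refl
  χ-inverseˡ (suc k) x with splitAt m k
  ... | inj₁ i = trans (reflexive (χ-tIdx i (s i x))) (ts-inv i x)
  ... | inj₂ i = trans (reflexive (χ-sIdx i (t i x))) (st-inv i x)

  χ-inverseʳ : ∀ a x → χ a (χ (inv a) x) ≈ x
  χ-inverseʳ zero x = refl
  χ-inverseʳ (suc k) x with splitAt m k
  ... | inj₁ i = trans (IsKAut.cong (s-aut i) (reflexive (χ-tIdx i x))) (st-inv i x)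
  ... | inj₂ i = trans (IsKAut.cong (t-aut i) (reflexive (χ-sIdx i x))) (ts-inv i x)

  ∘-aut : ∀ {τ τ′ : Carrier → Carrier} → IsKAut ι τ → IsKAut ι τ′ → IsKAut ι (λ x → τ (τ′ x))
  ∘-aut τ-aut τ′-aut = record
    { cong = λ x≈y → T.cong (T′.cong x≈y)
    ; hom+ = λ x y → trans (T.cong (T′.hom+ x y)) (T.hom+ _ _)
    ; hom* = λ x y → trans (T.cong (T′.hom* x y)) (T.hom* _ _)
    ; hom1 = trans (T.cong T′.hom1) T.hom1
    ; surj = λ y → let (y′ , τy′≈y) = T.surj y ; (x , τ′x≈y′) = T′.surj y′
                   in x , trans (T.cong τ′x≈y′) τy′≈y
    ; fixK = λ a → trans (T.cong (T′.fixK a)) (T.fixK a)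
    }
    where
    module T  = IsKAut τ-aut
    module T′ = IsKAut τ′-aut

  infixl 7 _·_
  _·_ : Fin n → Fin n → Fin n
  a · b = proj₁ (complete _ (∘-aut (χ-aut a) (χ-aut b)))

  χ-· : ∀ a b x → χ a (χ b x) ≈ χ (a · b) x
  χ-· a b = proj₂ (complete _ (∘-aut (χ-aut a) (χ-aut b)))

  χ-cong : ∀ a {x y} → x ≈ y → χ a x ≈ χ a y
  χ-cong a = IsKAut.cong (χ-aut a)

  ·-translateˡ : ∀ a k → a · (inv a · k) ≡ k
  ·-translateˡ a k = distinct _ _ λ x → begin
    χ (a · (inv a · k)) x      ≈⟨ χ-· a (inv a · k) x ⟨
    χ a (χ (inv a · k) x)      ≈⟨ χ-cong a (χ-· (inv a) k x) ⟨
    χ a (χ (inv a) (χ k x))    ≈⟨ χ-inverseʳ a (χ k x) ⟩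
    χ k x                      ∎

  ·-translateˡ⁻¹ : ∀ a k → inv a · (a · k) ≡ k
  ·-translateˡ⁻¹ a k = distinct _ _ λ x → begin
    χ (inv a · (a · k)) x      ≈⟨ χ-· (inv a) (a · k) x ⟨
    χ (inv a) (χ (a · k) x)    ≈⟨ χ-cong (inv a) (χ-· a k x) ⟨
    χ (inv a) (χ a (χ k x))    ≈⟨ χ-inverseˡ a (χ k x) ⟩
    χ k x                      ∎

  ·-translateʳ : ∀ a k → (k · inv a) · a ≡ k
  ·-translateʳ a k = distinct _ _ λ x → begin
    χ ((k · inv a) · a) x      ≈⟨ χ-· (k · inv a) a x ⟨
    χ (k · inv a) (χ a x)      ≈⟨ χ-· k (inv a) (χ a x) ⟨
    χ k (χ (inv a) (χ a x))    ≈⟨ χ-cong k (χ-inverseˡ a x) ⟩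
    χ k x                      ∎

  ·-translateʳ⁻¹ : ∀ a k → (k · a) · inv a ≡ k
  ·-translateʳ⁻¹ a k = distinct _ _ λ x → begin
    χ ((k · a) · inv a) x      ≈⟨ χ-· (k · a) (inv a) x ⟨
    χ (k · a) (χ (inv a) x)    ≈⟨ χ-· k a (χ (inv a) x) ⟨
    χ k (χ a (χ (inv a) x))    ≈⟨ χ-cong k (χ-inverseʳ a x) ⟩
    χ k x                      ∎

  inv-involutive : ∀ k → inv (inv k) ≡ k
  inv-involutive k = distinct _ _ λ x → begin
    χ (inv (inv k)) x                    ≈⟨ χ-inverseʳ k _ ⟨
    χ k (χ (inv k) (χ (inv (inv k)) x))  ≈⟨ χ-cong k (χ-inverseʳ (inv k) x) ⟩
    χ k x                                ∎

  inv·self : ∀ a → inv a · a ≡ zero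
  inv·self a = distinct _ _ λ x → trans (sym (χ-· (inv a) a x)) (χ-inverseˡ a x)

  sum-translateˡ : ∀ a (f : Fin n → Carrier) → sum (λ k → f (a · k)) ≈ sum f
  sum-translateˡ a f = sum-reindex f (a ·_) (inv a ·_) (·-translateˡ a) (·-translateˡ⁻¹ a)

  sum-translateʳ : ∀ a (f : Fin n → Carrier) → sum (λ k → f (k · a)) ≈ sum f
  sum-translateʳ a f = sum-reindex f (_· a) (_· inv a) (·-translateʳ a) (·-translateʳ⁻¹ a)

  sum-inv : ∀ (f : Fin n → Carrier) → sum (λ k → f (inv k)) ≈ sum f
  sum-inv f = sum-reindex f inv inv inv-involutive inv-involutive

  -- Dedekind's lemma

  dedekind-weak : ∀ {k} (ψ : Fin k → Carrier → Carrier) → (∀ i → IsKAut ι (ψ i)) →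
    (∀ i j → i ≢ j → ¬ (∀ x → ψ i x ≈ ψ j x)) →
    ∀ (c : Fin k → Carrier) → (∀ x → sum (λ i → c i * ψ i x) ≈ 0#) → ∀ i → ¬ ¬ c i ≈ 0#
  dedekind-weak {suc k} ψ ψ-aut ψ-distinct c relation = ∀-cons c₀≈0 c₊≈0
    where
    -- Multiplying the relation at y by ψ₀(x) and subtracting it from the relation
    -- at xy gives a relation among ψ₁, …, ψₖ.
    shifted : ∀ x y → sum (λ i → c (suc i) * (ψ (suc i) x - ψ zero x) * ψ (suc i) y) ≈ 0#
    shifted x y = begin
      sum (λ i → d (suc i) * ψ (suc i) y)
        ≈⟨ +-identityˡ _ ⟨
      0# + sum (λ i → d (suc i) * ψ (suc i) y)
        ≈⟨ +-congʳ (x≈0⇒x*y≈0 (ψ zero y) (y≈0⇒x*y≈0 (c zero) (-‿inverseʳ (ψ zero x)))) ⟨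
      sum (λ i → d i * ψ i y)
        ≈⟨ sum-cong-≋ expand ⟩
      sum (λ i → c i * ψ i (x * y) - ψ zero x * (c i * ψ i y))
        ≈⟨ sum-sub (λ i → c i * ψ i (x * y)) (λ i → ψ zero x * (c i * ψ i y)) ⟩
      sum (λ i → c i * ψ i (x * y)) - sum (λ i → ψ zero x * (c i * ψ i y))
        ≈⟨ +-congˡ (-‿cong (*-distribˡ-sum (ψ zero x) (λ i → c i * ψ i y))) ⟨
      sum (λ i → c i * ψ i (x * y)) - ψ zero x * sum (λ i → c i * ψ i y)
        ≈⟨ +-cong (relation (x * y)) (-‿cong (y≈0⇒x*y≈0 (ψ zero x) (relation y))) ⟩
      0# - 0#
        ≈⟨ -‿inverseʳ 0# ⟩
      0# ∎
      where
      d : Fin (suc k) → Carrier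
      d i = c i * (ψ i x - ψ zero x)
      expand : ∀ i → d i * ψ i y ≈ c i * ψ i (x * y) - ψ zero x * (c i * ψ i y)
      expand i = begin
        c i * (ψ i x - ψ zero x) * ψ i y                ≈⟨ *-congʳ (x[y-z]≈xy-xz (c i) _ _) ⟩
        (c i * ψ i x - c i * ψ zero x) * ψ i y          ≈⟨ [y-z]x≈yx-zx (ψ i y) _ _ ⟩
        c i * ψ i x * ψ i y - c i * ψ zero x * ψ i y    ≈⟨ +-cong (*-assoc _ _ _) (-‿cong (xy∙z≈y∙xz _ _ _)) ⟩
        c i * (ψ i x * ψ i y) - ψ zero x * (c i * ψ i y) ≈⟨ +-congʳ (*-congˡ (IsKAut.hom* (ψ-aut i) x y)) ⟨
        c i * ψ i (x * y) - ψ zero x * (c i * ψ i y)    ∎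
    c₊≈0 : ∀ i → ¬ ¬ c (suc i) ≈ 0#
    c₊≈0 i c₊≉0 = ¬¬-∀ agree λ agree →
      ψ-distinct (suc i) zero (λ ()) (automorphism-determinedOnBasis (ψ-aut (suc i)) (ψ-aut zero) agree)
      where
      c⁻¹ = proj₁ (inverse (c (suc i)) c₊≉0)
      agree : ∀ l → ¬ ¬ ψ (suc i) (e l) ≈ ψ zero (e l)
      agree l disagree = dedekind-weak (λ i → ψ (suc i)) (λ i → ψ-aut (suc i))
        (λ i j i≢j → ψ-distinct (suc i) (suc j) (λ 1+i≡1+j → i≢j (suc-injective 1+i≡1+j)))
        (λ i → c (suc i) * (ψ (suc i) (e l) - ψ zero (e l))) (shifted (e l)) i
        λ ≈0 → disagree (x∙y⁻¹≈ε⇒x≈y _ _ (begin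
          ψ (suc i) (e l) - ψ zero (e l)                        ≈⟨ *-identityˡ _ ⟨
          1# * (ψ (suc i) (e l) - ψ zero (e l))                 ≈⟨ *-congʳ (trans (*-comm _ _) (proj₂ (inverse (c (suc i)) c₊≉0))) ⟨
          c⁻¹ * c (suc i) * (ψ (suc i) (e l) - ψ zero (e l))    ≈⟨ *-assoc _ _ _ ⟩
          c⁻¹ * (c (suc i) * (ψ (suc i) (e l) - ψ zero (e l)))  ≈⟨ y≈0⇒x*y≈0 c⁻¹ ≈0 ⟩
          0#                                                    ∎))
    c₀≈0 : ¬ ¬ c zero ≈ 0#
    c₀≈0 c₀≉0 = ¬¬-∀ c₊≈0 λ c₊≈0 → c₀≉0 (begin
      c zero                                          ≈⟨ *-identityʳ _ ⟨
      c zero * 1#                                     ≈⟨ *-congˡ (IsKAut.hom1 (ψ-aut zero)) ⟨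
      c zero * ψ zero 1#                              ≈⟨ +-identityʳ _ ⟨
      c zero * ψ zero 1# + 0#                         ≈⟨ +-congˡ (sum-identity (λ i → x≈0⇒x*y≈0 _ (c₊≈0 i))) ⟨
      sum (λ i → c i * ψ i 1#)                        ≈⟨ relation 1# ⟩
      0#                                              ∎)

  M : Matrix n n
  M k j = χ k (e j)

  combination-onBasis : ∀ (c : Fin n → Carrier) x →
    sum (λ k → c k * χ k x) ≈ sum (λ j → ι (coordinates x j) * sum (λ k → c k * M k j))
  combination-onBasis c x = begin
    sum (λ k → c k * χ k x)
      ≈⟨ sum-cong-≋ (λ k → *-congˡ {c k} (Automorphism.expand-image (χ-aut k) x)) ⟩
    sum (λ k → c k * sum (λ j → ι (coordinates x j) * M k j))
      ≈⟨ sum-cong-≋ (λ k → trans (*-distribˡ-sum (c k) (λ j → ι (coordinates x j) * M k j))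
                                  (sum-cong-≋ (λ j → x∙yz≈y∙xz (c k) (ι (coordinates x j)) (M k j)))) ⟩
    sum (λ k → sum (λ j → ι (coordinates x j) * (c k * M k j)))
      ≈⟨ ∑-comm (λ k j → ι (coordinates x j) * (c k * M k j)) ⟩
    sum (λ j → sum (λ k → ι (coordinates x j) * (c k * M k j)))
      ≈⟨ sum-cong-≋ (λ j → *-distribˡ-sum (ι (coordinates x j)) (λ k → c k * M k j)) ⟨
    sum (λ j → ι (coordinates x j) * sum (λ k → c k * M k j)) ∎

  M-weaklyIndependent : WeaklyIndependentRows M
  M-weaklyIndependent c c·M≈0 = dedekind-weak χ χ-aut (λ i j i≢j agree → i≢j (distinct i j agree)) c
    λ x → trans (combination-onBasis c x) (sum-identity (λ j → y≈0⇒x*y≈0 (ι (coordinates x j)) (c·M≈0 j)))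

  dedekind : ∀ (c : Fin n → Carrier) → (∀ x → sum (λ k → c k * χ k x) ≈ 0#) → ∀ k → c k ≈ 0#
  dedekind c relation = independentRows M M-weaklyIndependent c (λ j → relation (e j))

  W : Matrix n n
  W = proj₁ (leftInverse M M-weaklyIndependent)

  W-inverse : IsLeftInverse W M
  W-inverse = proj₂ (leftInverse M M-weaklyIndependent)

  coordinate≈W : ∀ j y → ι (coordinates y j) ≈ sum (λ k → W j k * χ k y)
  coordinate≈W j y = sym (begin
    sum (λ k → W j k * χ k y)                                   ≈⟨ combination-onBasis (W j) y ⟩
    sum (λ l → ι (coordinates y l) * sum (λ k → W j k * M k l))
      ≈⟨ sum-extract (λ l → ι (coordinates y l) * sum (λ k → W j k * M k l)) j
           (λ l → y≈0⇒x*y≈0 _ (proj₂ W-inverse j _ (≡.≢-sym (punchInᵢ≢i j l)))) ⟩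
    ι (coordinates y j) * sum (λ k → W j k * M k j)             ≈⟨ *-congˡ (proj₁ W-inverse j) ⟩
    ι (coordinates y j) * 1#                                    ≈⟨ *-identityʳ _ ⟩
    ι (coordinates y j)                                         ∎)

  -- Trace and trace-dual basis

  trace : Carrier → Carrier
  trace a = sum (λ k → χ k a)

  tr≈trace : ∀ a → tr ι s t a ≈ trace a
  tr≈trace a = reflexive (sumFin≡sum (λ k → χ k a))

  trace-cong : ∀ {x y} → x ≈ y → trace x ≈ trace y
  trace-cong x≈y = sum-cong-≋ (λ k → χ-cong k x≈y)

  trace-+ : ∀ x y → trace (x + y) ≈ trace x + trace y
  trace-+ x y = trans (sum-cong-≋ (λ k → IsKAut.hom+ (χ-aut k) x y)) (∑-distrib-+ (λ k → χ k x) (λ k → χ k y))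

  open AdditiveHomomorphism commRing commRing trace trace-cong trace-+ using ()
    renaming (0#-homo to trace-0; -‿homo to trace-neg; sum-homo to trace-sum)

  trace-ι-linear : ∀ a z → trace (ι a * z) ≈ ι a * trace z
  trace-ι-linear a z = trans (sum-cong-≋ (λ k → Automorphism.ι-linear (χ-aut k) a z)) (sym (*-distribˡ-sum (ι a) (λ k → χ k z)))

  trace-mul : ∀ w y → trace (w * y) ≈ sum (λ k → χ k w * χ k y)
  trace-mul w y = sum-cong-≋ (λ k → IsKAut.hom* (χ-aut k) w y)

  trace-χ : ∀ a z → trace (χ a z) ≈ trace z
  trace-χ a z = trans (sum-cong-≋ (λ k → χ-· k a z)) (sum-translateʳ a (λ k → χ k z))

  χ-trace : ∀ a z → χ a (trace z) ≈ trace z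
  χ-trace a z = trans (Automorphism.sum-homo (χ-aut a) (λ k → χ k z))
    (trans (sum-cong-≋ (λ k → χ-· a k z)) (sum-translateˡ a (λ k → χ k z)))

  trace-nondegenerate : ∀ d → (∀ y → trace (d * y) ≈ 0#) → d ≈ 0#
  trace-nondegenerate d d⊥ = dedekind (λ k → χ k d) (λ y → trans (sym (trace-mul d y)) (d⊥ y)) zero

  W-equivariant : ∀ a j l → χ a (W j (inv a · l)) ≈ W j l
  W-equivariant a j l = x∙y⁻¹≈ε⇒x≈y _ _ (dedekind (λ l → A l - W j l) relation l)
    where
    A : Fin n → Carrier
    A l = χ a (W j (inv a · l))
    A-translated : ∀ y → sum (λ l → A l * χ l y) ≈ sum (λ k → W j k * χ k y)
    A-translated y = begin
      sum (λ l → A l * χ l y)                   ≈⟨ sum-translateˡ a (λ l → A l * χ l y) ⟨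
      sum (λ k → A (a · k) * χ (a · k) y)
        ≈⟨ sum-cong-≋ (λ k → *-cong (χ-cong a (reflexive (≡.cong (W j) (·-translateˡ⁻¹ a k)))) (sym (χ-· a k y))) ⟩
      sum (λ k → χ a (W j k) * χ a (χ k y))     ≈⟨ sum-cong-≋ (λ k → IsKAut.hom* (χ-aut a) (W j k) (χ k y)) ⟨
      sum (λ k → χ a (W j k * χ k y))           ≈⟨ Automorphism.sum-homo (χ-aut a) (λ k → W j k * χ k y) ⟨
      χ a (sum (λ k → W j k * χ k y))           ≈⟨ χ-cong a (coordinate≈W j y) ⟨
      χ a (ι (coordinates y j))                 ≈⟨ IsKAut.fixK (χ-aut a) (coordinates y j) ⟩
      ι (coordinates y j)                       ≈⟨ coordinate≈W j y ⟩
      sum (λ k → W j k * χ k y)                 ∎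
    relation : ∀ y → sum (λ l → (A l - W j l) * χ l y) ≈ 0#
    relation y = begin
      sum (λ l → (A l - W j l) * χ l y)                         ≈⟨ sum-cong-≋ (λ l → [y-z]x≈yx-zx (χ l y) (A l) (W j l)) ⟩
      sum (λ l → A l * χ l y - W j l * χ l y)                   ≈⟨ sum-sub (λ l → A l * χ l y) (λ l → W j l * χ l y) ⟩
      sum (λ l → A l * χ l y) - sum (λ l → W j l * χ l y)       ≈⟨ x≈y⇒x∙y⁻¹≈ε (A-translated y) ⟩
      0#                                                        ∎

  -- The trace-dual basis of e: the j-th row of W is the vector (χₖ(dual j))ₖ.
  dual : Fin n → Carrier
  dual j = W j zero

  χ-dual : ∀ a j → χ a (dual j) ≈ W j a
  χ-dual a j = trans (χ-cong a (reflexive (≡.cong (W j) (≡.sym (inv·self a))))) (W-equivariant a j a)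

  coordinate≈trace : ∀ j y → ι (coordinates y j) ≈ trace (dual j * y)
  coordinate≈trace j y = begin
    ι (coordinates y j)               ≈⟨ coordinate≈W j y ⟩
    sum (λ k → W j k * χ k y)         ≈⟨ sum-cong-≋ (λ k → *-congʳ {χ k y} (χ-dual k j)) ⟨
    sum (λ k → χ k (dual j) * χ k y)  ≈⟨ trace-mul (dual j) y ⟨
    trace (dual j * y)                ∎

  -- tr a is G-invariant, hence lies in ι(K); traceK a is its preimage.
  traceK : Carrier → K.Carrier
  traceK a = coordinates (trace a * e zero) zero

  ι-traceK : ∀ a → ι (traceK a) ≈ trace a
  ι-traceK a = begin
    ι (traceK a)
      ≈⟨ coordinate≈trace zero (trace a * e zero) ⟩
    trace (dual zero * (trace a * e zero))
      ≈⟨ trace-cong (x∙yz≈y∙xz (dual zero) (trace a) (e zero)) ⟩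
    trace (trace a * (dual zero * e zero))
      ≈⟨ sum-cong-≋ (λ k → trans (IsKAut.hom* (χ-aut k) (trace a) (dual zero * e zero)) (*-congʳ (χ-trace k a))) ⟩
    sum (λ k → trace a * χ k (dual zero * e zero))
      ≈⟨ *-distribˡ-sum (trace a) (λ k → χ k (dual zero * e zero)) ⟨
    trace a * trace (dual zero * e zero)
      ≈⟨ *-congˡ (trans (sym (coordinate≈trace zero (e zero))) (coordinate≈W zero (e zero))) ⟩
    trace a * sum (λ k → W zero k * M k zero)
      ≈⟨ trans (*-congˡ (proj₁ W-inverse zero)) (*-identityʳ _) ⟩
    trace a ∎

  -- The skew group ring L[G]

  act : (Fin n → Carrier) → Carrier → Carrier
  act c x = sum (λ k → c k * χ k x)

  act-injective : ∀ c c′ → (∀ x → act c x ≈ act c′ x) → ∀ k → c k ≈ c′ k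
  act-injective c c′ act≈ k = x∙y⁻¹≈ε⇒x≈y _ _ (dedekind (λ k → c k - c′ k) (λ x → begin
    sum (λ k → (c k - c′ k) * χ k x)               ≈⟨ sum-cong-≋ (λ k → [y-z]x≈yx-zx (χ k x) (c k) (c′ k)) ⟩
    sum (λ k → c k * χ k x - c′ k * χ k x)         ≈⟨ sum-sub (λ k → c k * χ k x) (λ k → c′ k * χ k x) ⟩
    act c x - act c′ x                             ≈⟨ x≈y⇒x∙y⁻¹≈ε (act≈ x) ⟩
    0#                                             ∎) k)

  act-cong-G : ∀ c c′ → c zero ≈ c′ zero → (∀ i → c (sIdx i) ≈ c′ (sIdx i)) → (∀ i → c (tIdx i) ≈ c′ (tIdx i)) →
    ∀ x → act c x ≈ act c′ x
  act-cong-G c c′ c₀≈ cₛ≈ cₜ≈ x = trans (sum-split-G (λ k → c k * χ k x)) (trans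
    (+-cong (*-congʳ c₀≈) (+-cong (sum-cong-≋ (λ i → *-congʳ (cₛ≈ i))) (sum-cong-≋ (λ i → *-congʳ (cₜ≈ i)))))
    (sym (sum-split-G (λ k → c′ k * χ k x))))

  -- The adjoint of ∑ₖ cₖ χₖ with respect to the trace form.
  adjoint : (Fin n → Carrier) → Fin n → Carrier
  adjoint c k = χ k (c (inv k))

  trace-act-adjoint : ∀ c x y → trace (act c x * y) ≈ trace (x * act (adjoint c) y)
  trace-act-adjoint c x y = begin
    trace (act c x * y)
      ≈⟨ trans (trace-cong (*-distribʳ-sum y (λ k → c k * χ k x))) (trace-sum (λ k → c k * χ k x * y)) ⟩
    sum (λ k → trace (c k * χ k x * y))
      ≈⟨ sum-cong-≋ moveInverse ⟩
    sum (λ k → trace (x * (χ (inv k) (c k) * χ (inv k) y)))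
      ≈⟨ trace-sum (λ k → x * (χ (inv k) (c k) * χ (inv k) y)) ⟨
    trace (sum (λ k → x * (χ (inv k) (c k) * χ (inv k) y)))
      ≈⟨ trace-cong (*-distribˡ-sum x (λ k → χ (inv k) (c k) * χ (inv k) y)) ⟨
    trace (x * sum (λ k → χ (inv k) (c k) * χ (inv k) y))
      ≈⟨ trace-cong (*-congˡ (sum-cong-≋ (λ k → *-congʳ {χ (inv k) y}
           (χ-cong (inv k) (reflexive (≡.cong c (≡.sym (inv-involutive k)))))))) ⟩
    trace (x * sum (λ k → χ (inv k) (c (inv (inv k))) * χ (inv k) y))
      ≈⟨ trace-cong (*-congˡ (sum-inv (λ k → χ k (c (inv k)) * χ k y))) ⟩
    trace (x * act (adjoint c) y) ∎
    where
    moveInverse : ∀ k → trace (c k * χ k x * y) ≈ trace (x * (χ (inv k) (c k) * χ (inv k) y))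
    moveInverse k = begin
      trace (c k * χ k x * y)                               ≈⟨ trace-χ (inv k) _ ⟨
      trace (χ (inv k) (c k * χ k x * y))                   ≈⟨ trace-cong (trans (I.hom* _ _) (*-congʳ (I.hom* _ _))) ⟩
      trace (χ (inv k) (c k) * χ (inv k) (χ k x) * χ (inv k) y) ≈⟨ trace-cong (*-congʳ (*-congˡ (χ-inverseˡ k x))) ⟩
      trace (χ (inv k) (c k) * x * χ (inv k) y)             ≈⟨ trace-cong (trans (*-congʳ (*-comm _ _)) (*-assoc _ _ _)) ⟩
      trace (x * (χ (inv k) (c k) * χ (inv k) y))           ∎
      where module I = IsKAut (χ-aut (inv k))

  adjoint-fixed : ∀ c → (∀ x y → trace (act c x * y) ≈ trace (act c y * x)) → ∀ k → adjoint c k ≈ c k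
  adjoint-fixed c symmetric = act-injective (adjoint c) c λ y →
    x∙y⁻¹≈ε⇒x≈y _ _ (trace-nondegenerate _ λ x → begin
      trace ((act (adjoint c) y - act c y) * x)
        ≈⟨ trace-cong ([y-z]x≈yx-zx x _ _) ⟩
      trace (act (adjoint c) y * x - act c y * x)
        ≈⟨ trans (trace-+ _ _) (+-congˡ (trace-neg _)) ⟩
      trace (act (adjoint c) y * x) - trace (act c y * x)
        ≈⟨ +-congʳ (trans (trace-cong (*-comm _ _)) (sym (trace-act-adjoint c x y))) ⟩
      trace (act c x * y) - trace (act c y * x)
        ≈⟨ x≈y⇒x∙y⁻¹≈ε (symmetric x y) ⟩
      0# ∎)

  -- The hypothesis says that f is K-linear: End_K(L) = L[G].
  K-linear⇒act : ∀ (f : Carrier → Carrier) → (∀ x → f x ≈ sum (λ l → ι (coordinates x l) * f (e l))) →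
    ∀ x → f x ≈ act (λ k → sum (λ l → χ k (dual l) * f (e l))) x
  K-linear⇒act f f-linear x = begin
    f x
      ≈⟨ f-linear x ⟩
    sum (λ l → ι (coordinates x l) * f (e l))
      ≈⟨ sum-cong-≋ (λ l → *-congʳ {f (e l)} (trans (coordinate≈trace l x) (trace-mul (dual l) x))) ⟩
    sum (λ l → sum (λ k → χ k (dual l) * χ k x) * f (e l))
      ≈⟨ sum-cong-≋ (λ l → trans (*-distribʳ-sum (f (e l)) (λ k → χ k (dual l) * χ k x))
                                  (sum-cong-≋ (λ k → xy∙z≈xz∙y (χ k (dual l)) (χ k x) (f (e l))))) ⟩
    sum (λ l → sum (λ k → χ k (dual l) * f (e l) * χ k x))
      ≈⟨ ∑-comm (λ l k → χ k (dual l) * f (e l) * χ k x) ⟩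
    sum (λ k → sum (λ l → χ k (dual l) * f (e l) * χ k x))
      ≈⟨ sum-cong-≋ (λ k → *-distribʳ-sum (χ k x) (λ l → χ k (dual l) * f (e l))) ⟨
    act (λ k → sum (λ l → χ k (dual l) * f (e l))) x ∎

  -- The forms φ_{b,σ}

  φ-integrand-linear : ∀ b c x x′ u u′ v z →
    b * ((c * x + x′) * v + (c * u + u′) * z) ≈ c * (b * (x * v + u * z)) + b * (x′ * v + u′ * z)
  φ-integrand-linear b c x x′ u u′ v z = begin
    b * ((c * x + x′) * v + (c * u + u′) * z)
      ≈⟨ *-congˡ (+-cong (distribʳ v (c * x) x′) (distribʳ z (c * u) u′)) ⟩
    b * ((c * x * v + x′ * v) + (c * u * z + u′ * z))
      ≈⟨ *-congˡ (+-interchange (c * x * v) (x′ * v) (c * u * z) (u′ * z)) ⟩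
    b * ((c * x * v + c * u * z) + (x′ * v + u′ * z))
      ≈⟨ distribˡ b _ _ ⟩
    b * (c * x * v + c * u * z) + b * (x′ * v + u′ * z)
      ≈⟨ +-congʳ (*-congˡ (trans (+-cong (*-assoc c x v) (*-assoc c u z)) (sym (distribˡ c (x * v) (u * z))))) ⟩
    b * (c * (x * v + u * z)) + b * (x′ * v + u′ * z)
      ≈⟨ +-congʳ (x∙yz≈y∙xz b c (x * v + u * z)) ⟩
    c * (b * (x * v + u * z)) + b * (x′ * v + u′ * z) ∎
    where open CommutativeSemigroupProperties +-commutativeSemigroup using () renaming (interchange to +-interchange)

  traceK-≈ : ∀ {a b} → trace a ≈ trace b → traceK a K.≈ traceK b
  traceK-≈ {a} {b} tra≈trb = ι-injective (trans (ι-traceK a) (trans tra≈trb (sym (ι-traceK b))))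

  φ-integrand : Carrier → (Carrier → Carrier) → Carrier → Carrier → Carrier
  φ-integrand b τ x y = b * (x * τ y + τ x * y)

  φ : Carrier → (τ : Carrier → Carrier) → IsKAut ι τ → SymForm ι
  φ b τ τ-aut = record
    { B      = λ x y → traceK (φ-integrand b τ x y)
    ; cong   = λ x≈x′ y≈y′ → traceK-≈ (trace-cong (*-congˡ (+-cong (*-cong x≈x′ (T.cong y≈y′)) (*-cong (T.cong x≈x′) y≈y′))))
    ; linear = linear
    ; symm   = λ x y → traceK-≈ (trace-cong (*-congˡ (trans (+-comm _ _) (+-cong (*-comm _ _) (*-comm _ _)))))
    }
    where
    module T = IsKAut τ-aut
    linear : ∀ a x x′ y → traceK (φ-integrand b τ (ι a * x + x′) y)
                          K.≈ a K.* traceK (φ-integrand b τ x y) K.+ traceK (φ-integrand b τ x′ y)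
    linear a x x′ y = ι-injective (begin
      ι (traceK (φ-integrand b τ (ι a * x + x′) y))
        ≈⟨ ι-traceK _ ⟩
      trace (b * ((ι a * x + x′) * τ y + τ (ι a * x + x′) * y))
        ≈⟨ trace-cong (*-congˡ (+-congˡ (*-congʳ (trans (T.hom+ _ _) (+-congʳ (Automorphism.ι-linear τ-aut a x)))))) ⟩
      trace (b * ((ι a * x + x′) * τ y + (ι a * τ x + τ x′) * y))
        ≈⟨ trace-cong (φ-integrand-linear b (ι a) x x′ (τ x) (τ x′) (τ y) y) ⟩
      trace (ι a * φ-integrand b τ x y + φ-integrand b τ x′ y)
        ≈⟨ trans (trace-+ _ _) (+-congʳ (trace-ι-linear a _)) ⟩
      ι a * trace (φ-integrand b τ x y) + trace (φ-integrand b τ x′ y)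
        ≈⟨ +-cong (*-congˡ (ι-traceK _)) (ι-traceK _) ⟨
      ι a * ι (traceK (φ-integrand b τ x y)) + ι (traceK (φ-integrand b τ x′ y))
        ≈⟨ trans (ι-+ _ _) (+-congʳ (ι-* _ _)) ⟨
      ι (a K.* traceK (φ-integrand b τ x y) K.+ traceK (φ-integrand b τ x′ y)) ∎)

  φ-represents : ∀ b τ τ-aut → Represents ι s t b τ (φ b τ τ-aut)
  φ-represents b τ τ-aut x y = trans (ι-traceK _) (sym (tr≈trace _))

  σ-aut : ∀ i → IsKAut ι (σ ι s t i)
  σ-aut zero    = id-aut
  σ-aut (suc i) = s-aut i

  -- The coefficients of ∑ᵢ φ_{bᵢ,σᵢ} in L[G]: 1 ↦ 2b₀, σᵢ ↦ bᵢ, σᵢ⁻¹ ↦ σᵢ⁻¹(bᵢ).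
  coefficients : (Fin (suc m) → Carrier) → Fin n → Carrier
  coefficients b zero    = b zero + b zero
  coefficients b (suc k) = [ (λ i → b (suc i)) , (λ i → t i (b (suc i))) ]′ (splitAt m k)

  coefficients-sIdx : ∀ b i → coefficients b (sIdx i) ≡ b (suc i)
  coefficients-sIdx b i rewrite splitAt-↑ˡ m i m = ≡.refl

  coefficients-tIdx : ∀ b i → coefficients b (tIdx i) ≡ t i (b (suc i))
  coefficients-tIdx b i rewrite splitAt-↑ʳ m m i = ≡.refl

  trace-moveAut : ∀ i b x y → trace (b * x * s i y) ≈ trace (t i b * t i x * y)
  trace-moveAut i b x y = begin
    trace (b * x * s i y)              ≈⟨ trace-χ (tIdx i) _ ⟨
    trace (χ (tIdx i) (b * x * s i y)) ≈⟨ trace-cong (reflexive (χ-tIdx i _)) ⟩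
    trace (t i (b * x * s i y))        ≈⟨ trace-cong (trans (T.hom* _ _) (*-cong (T.hom* b x) (ts-inv i y))) ⟩
    trace (t i b * t i x * y)          ∎
    where module T = IsKAut (t-aut i)

  sum-φ≈trace-act : ∀ b x y →
    sum (λ i → trace (φ-integrand (b i) (σ ι s t i) x y)) ≈ trace (act (coefficients b) x * y)
  sum-φ≈trace-act b x y = sym (begin
    trace (act c x * y)
      ≈⟨ trace-cong (*-distribʳ-sum y (λ k → c k * χ k x)) ⟩
    trace (sum (λ k → c k * χ k x * y))
      ≈⟨ trace-sum (λ k → c k * χ k x * y) ⟩
    sum g
      ≈⟨ sum-split-G g ⟩
    g zero + (sum (λ i → g (sIdx i)) + sum (λ i → g (tIdx i)))
      ≈⟨ +-cong (trace-cong (double-distrib (b zero) x y)) (+-cong (sum-cong-≋ g-sIdx) (sum-cong-≋ g-tIdx)) ⟩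
    trace (φ-integrand (b zero) (λ x → x) x y) + (sum (λ i → trace (P i)) + sum (λ i → trace (Q i)))
      ≈⟨ +-congˡ (trans (+-comm _ _) (sym (∑-distrib-+ (λ i → trace (Q i)) (λ i → trace (P i))))) ⟩
    trace (φ-integrand (b zero) (λ x → x) x y) + sum (λ i → trace (Q i) + trace (P i))
      ≈⟨ +-congˡ (sum-cong-≋ (λ i → trans (sym (trace-+ (Q i) (P i))) (trace-cong (split i)))) ⟩
    sum (λ i → trace (φ-integrand (b i) (σ ι s t i) x y)) ∎)
    where
    c = coefficients b
    g : Fin n → Carrier
    g k = trace (c k * χ k x * y)
    P Q : Fin m → Carrier
    P i = b (suc i) * s i x * y
    Q i = b (suc i) * x * s i y
    double-distrib : ∀ a x y → (a + a) * x * y ≈ a * (x * y + x * y)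
    double-distrib a x y = trans (*-assoc _ _ _) (trans (distribʳ (x * y) a a) (sym (distribˡ a (x * y) (x * y))))
    g-sIdx : ∀ i → g (sIdx i) ≈ trace (P i)
    g-sIdx i = trace-cong (*-congʳ (*-cong (reflexive (coefficients-sIdx b i)) (reflexive (χ-sIdx i x))))
    g-tIdx : ∀ i → g (tIdx i) ≈ trace (Q i)
    g-tIdx i = trans (trace-cong (*-congʳ (*-cong (reflexive (coefficients-tIdx b i)) (reflexive (χ-tIdx i x)))))
                     (sym (trace-moveAut i (b (suc i)) x y))
    split : ∀ i → Q i + P i ≈ φ-integrand (b (suc i)) (s i) x y
    split i = trans (+-cong (*-assoc _ _ _) (*-assoc _ _ _)) (sym (distribˡ (b (suc i)) _ _))

  φ-sum-injective : ∀ b → (∀ x y → sum (λ i → trace (φ-integrand (b i) (σ ι s t i) x y)) ≈ 0#) →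
    ∀ i → b i ≈ 0#
  φ-sum-injective b vanishes = b≈0
    where
    act≈0 : ∀ x → act (coefficients b) x ≈ 0#
    act≈0 x = trace-nondegenerate _ (λ y → trans (sym (sum-φ≈trace-act b x y)) (vanishes x y))
    c≈0 : ∀ k → coefficients b k ≈ 0#
    c≈0 = dedekind (coefficients b) act≈0
    b≈0 : ∀ i → b i ≈ 0#
    b≈0 zero    = double-injective (b zero) (c≈0 zero)
    b≈0 (suc i) = trans (reflexive (≡.sym (coefficients-sIdx b i))) (c≈0 (sIdx i))

  φ-injective : ∀ j b b′ → (∀ x y → trace (φ-integrand b (σ ι s t j) x y) ≈ trace (φ-integrand b′ (σ ι s t j) x y)) →
    b ≈ b′
  φ-injective j b b′ same = x∙y⁻¹≈ε⇒x≈y b b′ (begin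
    b - b′  ≡⟨ updateAt-updates j (λ _ → 0#) ⟨
    v j     ≈⟨ φ-sum-injective v vanishes j ⟩
    0#      ∎)
    where
    v : Fin (suc m) → Carrier
    v = updateAt (λ _ → 0#) j (λ _ → b - b′)
    vanishes : ∀ x y → sum (λ k → trace (φ-integrand (v k) (σ ι s t k) x y)) ≈ 0#
    vanishes x y = begin
      sum (λ k → trace (φ-integrand (v k) (σ ι s t k) x y))
        ≈⟨ sum-extract (λ k → trace (φ-integrand (v k) (σ ι s t k) x y)) j (λ k → trans
             (trace-cong (x≈0⇒x*y≈0 _ (reflexive (updateAt-minimal (punchIn j k) j (λ _ → 0#) (punchInᵢ≢i j k)))))
             trace-0) ⟩
      trace (v j * Q)                 ≡⟨ ≡.cong (λ z → trace (z * Q)) (updateAt-updates j (λ _ → 0#)) ⟩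
      trace ((b - b′) * Q)            ≈⟨ trace-cong ([y-z]x≈yx-zx Q b b′) ⟩
      trace (b * Q - b′ * Q)          ≈⟨ trans (trace-+ _ _) (+-congˡ (trace-neg _)) ⟩
      trace (b * Q) - trace (b′ * Q)  ≈⟨ x≈y⇒x∙y⁻¹≈ε (same x y) ⟩
      0#                              ∎
      where Q = x * σ ι s t j y + σ ι s t j x * y

  module FormDecomposition (F : SymForm ι) where
    open SymForm F using (B) renaming (cong to B-cong; linear to B-linear; symm to B-symm)

    B-zeroˡ : ∀ y → B 0# y K.≈ K.0#
    B-zeroˡ y = KR.x+x≈x⇒x≈0 (B 0# y) (K.trans (K.+-congʳ (K.sym (K.*-identityˡ (B 0# y))))
      (K.trans (K.sym (B-linear K.1# 0# 0# y)) (B-cong (trans (+-identityʳ _) (zeroʳ _)) refl)))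

    B-linear-sum : ∀ {p} (a : Fin p → K.Carrier) (v : Fin p → Carrier) y →
      B (sum (λ j → ι (a j) * v j)) y K.≈ ΣK.sum (λ j → a j K.* B (v j) y)
    B-linear-sum {zero}  a v y = B-zeroˡ y
    B-linear-sum {suc p} a v y = K.trans (B-linear (a zero) (v zero) _ y)
                                   (K.+-congˡ (B-linear-sum (λ j → a (suc j)) (λ j → v (suc j)) y))

    h : Carrier → Carrier
    h x = sum (λ j → ι (B x (e j)) * dual j)

    ι-B≈trace-h : ∀ x y → ι (B x y) ≈ trace (h x * y)
    ι-B≈trace-h x y = begin
      ι (B x y)
        ≈⟨ ι-cong (K.trans (B-symm x y) (B-cong (expand-in-basis y) refl)) ⟩
      ι (B (sum (λ j → ι (coordinates y j) * e j)) x)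
        ≈⟨ trans (ι-cong (B-linear-sum (coordinates y) e x)) (ι-sum (λ j → coordinates y j K.* B (e j) x)) ⟩
      sum (λ j → ι (coordinates y j K.* B (e j) x))
        ≈⟨ sum-cong-≋ term ⟩
      sum (λ j → trace (ι (B x (e j)) * (dual j * y)))
        ≈⟨ trace-sum (λ j → ι (B x (e j)) * (dual j * y)) ⟨
      trace (sum (λ j → ι (B x (e j)) * (dual j * y)))
        ≈⟨ trace-cong (trans (sum-cong-≋ (λ j → sym (*-assoc (ι (B x (e j))) (dual j) y)))
                             (sym (*-distribʳ-sum y (λ j → ι (B x (e j)) * dual j)))) ⟩
      trace (h x * y) ∎
      where
      term : ∀ j → ι (coordinates y j K.* B (e j) x) ≈ trace (ι (B x (e j)) * (dual j * y))
      term j = begin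
        ι (coordinates y j K.* B (e j) x)     ≈⟨ ι-* _ _ ⟩
        ι (coordinates y j) * ι (B (e j) x)   ≈⟨ *-cong (coordinate≈trace j y) (ι-cong (B-symm (e j) x)) ⟩
        trace (dual j * y) * ι (B x (e j))    ≈⟨ *-comm _ _ ⟩
        ι (B x (e j)) * trace (dual j * y)    ≈⟨ trace-ι-linear _ _ ⟨
        trace (ι (B x (e j)) * (dual j * y))  ∎

    h-linear : ∀ x → h x ≈ sum (λ l → ι (coordinates x l) * h (e l))
    h-linear x = begin
      sum (λ j → ι (B x (e j)) * dual j)
        ≈⟨ sum-cong-≋ (λ j → *-congʳ {dual j}
             (trans (ι-cong (K.trans (B-cong (expand-in-basis x) refl) (B-linear-sum (coordinates x) e (e j))))
                    (ι-sum (λ l → coordinates x l K.* B (e l) (e j))))) ⟩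
      sum (λ j → sum (λ l → ι (coordinates x l K.* B (e l) (e j))) * dual j)
        ≈⟨ sum-cong-≋ (λ j → trans (*-distribʳ-sum (dual j) (λ l → ι (coordinates x l K.* B (e l) (e j))))
                                    (sum-cong-≋ (λ l → trans (*-congʳ {dual j} (ι-* (coordinates x l) (B (e l) (e j)))) (*-assoc _ _ _)))) ⟩
      sum (λ j → sum (λ l → ι (coordinates x l) * (ι (B (e l) (e j)) * dual j)))
        ≈⟨ ∑-comm (λ j l → ι (coordinates x l) * (ι (B (e l) (e j)) * dual j)) ⟩
      sum (λ l → sum (λ j → ι (coordinates x l) * (ι (B (e l) (e j)) * dual j)))
        ≈⟨ sum-cong-≋ (λ l → *-distribˡ-sum (ι (coordinates x l)) (λ j → ι (B (e l) (e j)) * dual j)) ⟨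
      sum (λ l → ι (coordinates x l) * h (e l)) ∎

    c : Fin n → Carrier
    c k = sum (λ l → χ k (dual l) * h (e l))

    ι-B≈trace-act : ∀ x y → ι (B x y) ≈ trace (act c x * y)
    ι-B≈trace-act x y = trans (ι-B≈trace-h x y) (trace-cong (*-congʳ (K-linear⇒act h h-linear x)))

    c-selfAdjoint : ∀ k → adjoint c k ≈ c k
    c-selfAdjoint = adjoint-fixed c λ x y →
      trans (sym (ι-B≈trace-act x y)) (trans (ι-cong (B-symm x y)) (ι-B≈trace-act y x))

    b : Fin (suc m) → Carrier
    b zero    = ½ * c zero
    b (suc i) = c (sIdx i)

    act-coefficients : ∀ x → act (coefficients b) x ≈ act c x
    act-coefficients = act-cong-G (coefficients b) c (½x+½x≈x (c zero)) (λ i → reflexive (coefficients-sIdx b i)) λ i → begin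
      coefficients b (tIdx i)        ≡⟨ coefficients-tIdx b i ⟩
      t i (c (sIdx i))               ≡⟨ χ-tIdx i _ ⟨
      χ (tIdx i) (c (sIdx i))        ≡⟨ ≡.cong (χ (tIdx i) ∘ c) (inv-tIdx i) ⟨
      adjoint c (tIdx i)             ≈⟨ c-selfAdjoint (tIdx i) ⟩
      c (tIdx i)                     ∎

    components : Fin (suc m) → SymForm ι
    components i = φ (b i) (σ ι s t i) (σ-aut i)

    decomposition : ∀ x y → B x y K.≈ ΣK.sum (λ i → SymForm.B (components i) x y)
    decomposition x y = ι-injective (begin
      ι (B x y)                                                 ≈⟨ ι-B≈trace-act x y ⟩
      trace (act c x * y)                                       ≈⟨ trace-cong (*-congʳ (act-coefficients x)) ⟨
      trace (act (coefficients b) x * y)                        ≈⟨ sum-φ≈trace-act b x y ⟨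
      sum (λ i → trace (φ-integrand (b i) (σ ι s t i) x y))     ≈⟨ sum-cong-≋ (λ i → ι-traceK (φ-integrand (b i) (σ ι s t i) x y)) ⟨
      sum (λ i → ι (SymForm.B (components i) x y))              ≈⟨ ι-sum (λ i → SymForm.B (components i) x y) ⟨
      ι (ΣK.sum (λ i → SymForm.B (components i) x y))           ∎)

  represents⇒trace : ∀ b τ F → Represents ι s t b τ F → ∀ x y → ι (SymForm.B F x y) ≈ trace (φ-integrand b τ x y)
  represents⇒trace b τ F represents x y = trans (represents x y) (tr≈trace _)

  sum-direct : (Fs : Fin (suc m) → SymForm ι) → (∀ i → InA ι s t i (Fs i)) →
    (∀ x y → sumFin K.commRing (λ i → SymForm.B (Fs i) x y) K.≈ K.0#) → ∀ i x y → SymForm.B (Fs i) x y K.≈ K.0#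
  sum-direct Fs inA vanishes i x y = ι-injective (begin
    ι (SymForm.B (Fs i) x y)                      ≈⟨ ι-Fs≈trace i x y ⟩
    trace (φ-integrand (b i) (σ ι s t i) x y)     ≈⟨ trace-cong (x≈0⇒x*y≈0 _ (φ-sum-injective b sum≈0 i)) ⟩
    trace 0#                                      ≈⟨ trace-0 ⟩
    0#                                            ≈⟨ ι-0 ⟨
    ι K.0#                                        ∎)
    where
    b : Fin (suc m) → Carrier
    b i = proj₁ (inA i)
    ι-Fs≈trace : ∀ i x y → ι (SymForm.B (Fs i) x y) ≈ trace (φ-integrand (b i) (σ ι s t i) x y)
    ι-Fs≈trace i = represents⇒trace (b i) (σ ι s t i) (Fs i) (proj₂ (inA i))
    sum≈0 : ∀ x y → sum (λ i → trace (φ-integrand (b i) (σ ι s t i) x y)) ≈ 0#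
    sum≈0 x y = begin
      sum (λ i → trace (φ-integrand (b i) (σ ι s t i) x y))  ≈⟨ sum-cong-≋ (λ i → ι-Fs≈trace i x y) ⟨
      sum (λ i → ι (SymForm.B (Fs i) x y))                   ≈⟨ ι-sum (λ i → SymForm.B (Fs i) x y) ⟨
      ι (ΣK.sum (λ i → SymForm.B (Fs i) x y))                ≡⟨ ≡.cong ι (ΣK.sumFin≡sum (λ i → SymForm.B (Fs i) x y)) ⟨
      ι (sumFin K.commRing (λ i → SymForm.B (Fs i) x y))     ≈⟨ trans (ι-cong (vanishes x y)) ι-0 ⟩
      0#                                                     ∎

  every-form-decomposes : (F : SymForm ι) → Σ (Fin (suc m) → SymForm ι) λ Fs →
    (∀ i → InA ι s t i (Fs i)) × (∀ x y → SymForm.B F x y K.≈ sumFin K.commRing (λ i → SymForm.B (Fs i) x y))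
  every-form-decomposes F = components , (λ i → b i , φ-represents (b i) (σ ι s t i) (σ-aut i)) ,
    λ x y → K.trans (decomposition x y) (K.reflexive (≡.sym (ΣK.sumFin≡sum (λ i → SymForm.B (components i) x y))))
    where open FormDecomposition F

  φ-injective-on-A : ∀ i b b′ F F′ → Represents ι s t b (s i) F → Represents ι s t b′ (s i) F′ →
    (∀ x y → SymForm.B F x y K.≈ SymForm.B F′ x y) → b ≈ b′
  φ-injective-on-A i b b′ F F′ represents represents′ same = φ-injective (suc i) b b′ λ x y →
    trans (sym (represents⇒trace b (s i) F represents x y))
          (trans (ι-cong (same x y)) (represents⇒trace b′ (s i) F′ represents′ x y))

  -- Norms and non-degeneracy

  norm : Carrier → Carrier
  norm z = Product.sum (λ k → χ k z)

  norm-cong : ∀ {x y} → x ≈ y → norm x ≈ norm y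
  norm-cong x≈y = Product.sum-cong-≋ (λ k → χ-cong k x≈y)

  norm-* : ∀ x y → norm (x * y) ≈ norm x * norm y
  norm-* x y = trans (Product.sum-cong-≋ (λ k → IsKAut.hom* (χ-aut k) x y)) (Product.∑-distrib-+ (λ k → χ k x) (λ k → χ k y))

  norm-χ : ∀ a z → norm (χ a z) ≈ norm z
  norm-χ a z = trans (Product.sum-cong-≋ (λ k → χ-· k a z))
                     (Product.sum-reindex (λ k → χ k z) (_· a) (_· inv a) (·-translateʳ a) (·-translateʳ⁻¹ a))

  norm-≉0 : ∀ {z} → ¬ z ≈ 0# → ¬ norm z ≈ 0#
  norm-≉0 z≉0 = product-≉0 _ (λ k → Automorphism.≉0-preserving (χ-aut k) z≉0)

  -- Uses that [L : K] = 2m + 1 is odd.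
  norm-[-1] : norm (- 1#) ≈ - 1#
  norm-[-1] = begin
    Product.sum (λ k → χ k (- 1#))
      ≈⟨ Product.sum-cong-≋ (λ k → trans (Automorphism.-‿homo (χ-aut k) 1#) (-‿cong (IsKAut.hom1 (χ-aut k)))) ⟩
    - 1# * Product.sum {m +ℕ m} (λ _ → - 1#)
      ≈⟨ *-congˡ (Product.sum-↑ m m (λ _ → - 1#)) ⟩
    - 1# * (Product.sum {m} (λ _ → - 1#) * Product.sum {m} (λ _ → - 1#))
      ≈⟨ *-congˡ (Product.∑-distrib-+ {m} (λ _ → - 1#) (λ _ → - 1#)) ⟨
    - 1# * Product.sum {m} (λ _ → - 1# * - 1#)
      ≈⟨ *-congˡ (Product.sum-identity {m} (λ _ → trans (-x*-y≈x*y 1# 1#) (*-identityˡ 1#))) ⟩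
    - 1# * 1#
      ≈⟨ *-identityʳ _ ⟩
    - 1# ∎

  twisted : Fin m → Carrier → Carrier → Carrier
  twisted i b x = t i (b * x) + b * s i x

  trace-φ≈trace-twisted : ∀ i b x y → trace (φ-integrand b (s i) x y) ≈ trace (twisted i b x * y)
  trace-φ≈trace-twisted i b x y = begin
    trace (b * (x * s i y + s i x * y))
      ≈⟨ trace-cong (trans (distribˡ b _ _) (+-cong (sym (*-assoc b x (s i y))) (sym (*-assoc b (s i x) y)))) ⟩
    trace (b * x * s i y + b * s i x * y)
      ≈⟨ trace-+ _ _ ⟩
    trace (b * x * s i y) + trace (b * s i x * y)
      ≈⟨ +-congʳ (trans (trace-moveAut i b x y) (trace-cong (*-congʳ (sym (IsKAut.hom* (t-aut i) b x))))) ⟩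
    trace (t i (b * x) * y) + trace (b * s i x * y)
      ≈⟨ trace-+ _ _ ⟨
    trace (t i (b * x) * y + b * s i x * y)
      ≈⟨ trace-cong (sym (distribʳ y _ _)) ⟩
    trace (twisted i b x * y) ∎

  -- Taking norms in sᵢ⁻¹(bx) = −b sᵢ(x) would give N(b)N(x) = N(−1)N(b)N(x) = −N(b)N(x).
  twisted-≉0 : ∀ i {b x} → ¬ b ≈ 0# → ¬ x ≈ 0# → ¬ twisted i b x ≈ 0#
  twisted-≉0 i {b} {x} b≉0 x≉0 twisted≈0 =
    x≉0∧y≉0⇒x*y≉0 (norm-≉0 b≉0) (norm-≉0 x≉0) (double-injective _ (begin
      norm b * norm x + norm b * norm x      ≈⟨ +-congˡ P≈-P ⟩
      norm b * norm x - norm b * norm x      ≈⟨ -‿inverseʳ _ ⟩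
      0#                                     ∎))
    where
    P≈-P : norm b * norm x ≈ - (norm b * norm x)
    P≈-P = begin
      norm b * norm x              ≈⟨ norm-* b x ⟨
      norm (b * x)                 ≈⟨ norm-χ (tIdx i) (b * x) ⟨
      norm (χ (tIdx i) (b * x))    ≈⟨ norm-cong (trans (reflexive (χ-tIdx i (b * x))) (+-inverseʳ-unique _ _ (trans (+-comm _ _) twisted≈0))) ⟩
      norm (- (b * s i x))         ≈⟨ norm-cong (-1*x≈-x _) ⟨
      norm (- 1# * (b * s i x))    ≈⟨ trans (norm-* _ _) (*-congˡ (norm-* _ _)) ⟩
      norm (- 1#) * (norm b * norm (s i x))
        ≈⟨ *-cong norm-[-1] (*-congˡ (trans (norm-cong (reflexive (≡.sym (χ-sIdx i x)))) (norm-χ (sIdx i) x))) ⟩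
      - 1# * (norm b * norm x)     ≈⟨ -1*x≈-x _ ⟩
      - (norm b * norm x)          ∎

  φ-nondegenerate : ∀ i (F : SymForm ι) → InA ι s t (suc i) F →
    Σ Carrier (λ x₀ → Σ Carrier λ y₀ → ¬ SymForm.B F x₀ y₀ K.≈ K.0#) →
    ∀ x → ¬ x ≈ 0# → Σ Carrier λ y → ¬ SymForm.B F x y K.≈ K.0#
  φ-nondegenerate i F (b , represents) (x₀ , y₀ , B₀≉0) x x≉0 = ρ⁻¹ * z₀ , B≉0
    where
    ι-B≈trace : ∀ x y → ι (SymForm.B F x y) ≈ trace (twisted i b x * y)
    ι-B≈trace x y = trans (represents⇒trace b (s i) F represents x y) (trace-φ≈trace-twisted i b x y)
    z₀ = twisted i b x₀ * y₀
    trace-z₀≉0 : ¬ trace z₀ ≈ 0#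
    trace-z₀≉0 tr≈0 = B₀≉0 (ι-injective (trans (ι-B≈trace x₀ y₀) (trans tr≈0 (sym ι-0))))
    b≉0 : ¬ b ≈ 0#
    b≉0 b≈0 = trace-z₀≉0 (trans (trace-cong (x≈0⇒x*y≈0 y₀ twisted≈0)) trace-0)
      where
      twisted≈0 : twisted i b x₀ ≈ 0#
      twisted≈0 = trans (+-cong (trans (IsKAut.cong (t-aut i) (x≈0⇒x*y≈0 x₀ b≈0)) (Automorphism.0#-homo (t-aut i)))
                                (x≈0⇒x*y≈0 _ b≈0)) (+-identityˡ 0#)
    ρ⁻¹ = proj₁ (inverse (twisted i b x) (twisted-≉0 i b≉0 x≉0))
    B≉0 : ¬ SymForm.B F x (ρ⁻¹ * z₀) K.≈ K.0#
    B≉0 B≈0 = trace-z₀≉0 (begin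
      trace z₀                               ≈⟨ trace-cong (*-identityˡ z₀) ⟨
      trace (1# * z₀)                        ≈⟨ trace-cong (*-congʳ (proj₂ (inverse (twisted i b x) (twisted-≉0 i b≉0 x≉0)))) ⟨
      trace (twisted i b x * ρ⁻¹ * z₀)       ≈⟨ trace-cong (*-assoc _ _ _) ⟩
      trace (twisted i b x * (ρ⁻¹ * z₀))     ≈⟨ ι-B≈trace x (ρ⁻¹ * z₀) ⟨
      ι (SymForm.B F x (ρ⁻¹ * z₀))           ≈⟨ trans (ι-cong B≈0) ι-0 ⟩
      0#                                     ∎)

mainTheorem6 : ∀ {c₁ ℓ₁ c₂ ℓ₂} (K : Field c₁ ℓ₁) (L : Field c₂ ℓ₂) → CharNot2 K →
  (ι : Field.Carrier K → Field.Carrier L) → Ext.IsRingHom K L ι →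
  (m : ℕ) (s t : Fin m → Field.Carrier L → Field.Carrier L) →
  Ext.IsGaloisGroupEnum K L ι m s t →
  let open Ext K L
      _≈K_ = Field._≈_ K
      _≈L_ = Field._≈_ L
      0K = Field.0# K
      0L = Field.0# L
      B = SymForm.B
  in
  -- (1) every symmetric bilinear form is a sum of elements of A⁰, …, Aᵐ
  ((F : SymForm ι) → Σ (Fin (suc m) → SymForm ι) λ Fs →
      ((i : Fin (suc m)) → InA ι s t i (Fs i)) ×
      (∀ x y → B F x y ≈K sumFin (Field.commRing K) (λ i → B (Fs i) x y)))
  ×
  -- (2) the sum is direct
  ((Fs : Fin (suc m) → SymForm ι) → ((i : Fin (suc m)) → InA ι s t i (Fs i)) →
      (∀ x y → sumFin (Field.commRing K) (λ i → B (Fs i) x y) ≈K 0K) →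
      ∀ i x y → B (Fs i) x y ≈K 0K)
  ×
  -- (3) for 1 ≤ i ≤ m, b ↦ φ_{b,σ_i} is a bijection L → Aⁱ (so dim Aⁱ = n) and
  --     every nonzero element of Aⁱ is non-degenerate (rank n)
  ((i : Fin m) →
      ((b : Field.Carrier L) → Σ (SymForm ι) (Represents ι s t b (s i)))
    × (∀ b b' F F' → Represents ι s t b (s i) F → Represents ι s t b' (s i) F' →
          (∀ x y → B F x y ≈K B F' x y) → b ≈L b')
    × ((F : SymForm ι) → InA ι s t (suc i) F →
          Σ (Field.Carrier L) (λ x → Σ (Field.Carrier L) λ y → ¬ (B F x y ≈K 0K)) →
          ∀ x → ¬ (x ≈L 0L) → Σ (Field.Carrier L) λ y → ¬ (B F x y ≈K 0K)))
mainTheorem6 K L char≢2 ι ι-hom m s t galois =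
  every-form-decomposes , sum-direct ,
  λ i → (λ b → φ b (s i) (s-aut i) , φ-represents b (s i) (s-aut i)) , φ-injective-on-A i , φ-nondegenerate i
  where
  open Galois K L char≢2 ι ι-hom m s t galois
  open Ext.IsGaloisGroupEnum galois using (s-aut)
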